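{- Let $n\ge1$ and let $W(n)=\{D_\pi:\pi\in S_n\}$. For $\pi,\sigma\in S_n$ with $m=\mathrm{minimal}(\pi,\sigma)$, $$M^{(W(n))}_{D_\pi,D_\sigma}(x)=x^m(1+x)^{n-m}\quad\text{and}\quad R^{(W(n))}_{D_\pi,D_\sigma}=\frac{(-1)^{m-1}}{n\binom{n-1}{m-1}}.$$ Consequently $R^{(W(n))}_{D_\pi,D_\pi}=1/n$, $\operatorname{tr}R^{(W(n))}=(n-1)!$, $M^{(W(n))}_{D_\pi,D_\pi}(x)=x(1+x)^{n-1}$, and $\operatorname{tr}M^{(W(n))}(x)=n!\,x(1+x)^{n-1}$.
   Context: A 4-tuple $(x,y,a,b)$ denotes an edge from peg $x$ at height $a$ to peg $y$ at height $b$ (height 1 is the bottom). For $\pi\in S_n$, $D_\pi=\{e_i=(\pi(i),n+1,1,i):1\le i\le n\}$, a web diagram on $n+1$ pegs; $W(n)$ is the web world of any $D_\pi$ (all diagrams obtained by permuting heights on each peg). Sum: $D\oplus D'=D\cup\{(x',y',a'+p_{x'}(D),b'+p_{y'}(D)):(x',y',a',b')\in D'\}$, with $p_i(D)$ the number of endpoints of $D$ on peg $i$. $\mathrm{rel}(X)$ relabels heights of endpoints of edges of $X$ on each peg by $1,\dots,\ell_i$ preserving relative order. An $\ell$-colouring of $D$ is a surjection from the edges onto $\{1,\dots,\ell\}$; with $D_c(t)$ the edges of colour $t$, $\mathcal{R}(D,c)=\mathrm{rel}(D_c(1))\oplus\cdots\oplus\mathrm{rel}(D_c(\ell))$. $f(D_1,D_2,\ell)$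 is the number of $\ell$-colourings $c$ of $D_1$ with $\mathcal{R}(D_1,c)=D_2$; $M^{(W)}_{D_1,D_2}(x)=\sum_{\ell\ge1}x^\ell f(D_1,D_2,\ell)$ and $R^{(W)}_{D_1,D_2}=\sum_{\ell\ge1}\frac{(-1)^{\ell-1}}{\ell}f(D_1,D_2,\ell)$. For $\pi,\sigma\in S_n$, $\mathrm{minimal}(\pi,\sigma)=1+|\{1\le j<n:\pi^{ -1}(\sigma(j+1))<\pi^{ -1}(\sigma(j))\}|$ (the number of left-to-right passes through $\pi$ needed to read $\sigma(1),\dots,\sigma(n)$ in order). -}

module Defs where

open import Data.Nat as ℕ using (ℕ; zero; suc; _+_; _*_; _∸_; _<?_; _≟_)
open import Data.Integer as ℤ using (ℤ; +_)
open import Data.Rational as ℚ using (ℚ; _/_; 0ℚ)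
open import Data.Fin as Fin using (Fin; toℕ)
open import Data.Fin.Properties as FinP using ()
open import Data.Fin.Permutation using (Permutation′; _⟨$⟩ʳ_; _⟨$⟩ˡ_)
open import Data.Vec as Vec using (Vec; []; _∷_; toList)
open import Data.List as List using (List; []; _∷_; _++_; map; length; filter; concatMap; foldl; foldr; allFin; upTo; zip; replicate)
open import Data.Nat.ListAction renaming (sum to sumℕ)
open import Data.List.Relation.Unary.All as All using (All; all?)
open import Data.List.Membership.Propositional using (_∈_)
open import Data.List.Membership.DecPropositional as DecMem using ()
open import Data.List.Relation.Unary.Unique.DecPropositional as UniqDec using ()
open import Data.Product using (_×_; _,_; proj₁; proj₂)
open import Data.Product.Properties using (≡-dec)
open import Relation.Binary.Definitions using (DecidableEquality)
open import Relation.Nullary using (Dec; yes; no)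
import Relation.Nullary
open import Data.Bool using (if_then_else_)
open import Relation.Nullary.Decidable using (_×-dec_)

-- Web diagrams
-- An edge (x , y , a , b): from peg x at height a to peg y at height b.
-- A diagram is a finite set of edges, represented as a list of (pairwise
-- distinct) edges.

Edge : Set
Edge = ℕ × ℕ × ℕ × ℕ

Diagram : Set
Diagram = List Edge

_≟E_ : DecidableEquality Edge
_≟E_ = ≡-dec _≟_ (≡-dec _≟_ (≡-dec _≟_ _≟_))

endpoints : Edge → List (ℕ × ℕ)
endpoints (x , y , a , b) = (x , a) ∷ (y , b) ∷ []

allEndpoints : Diagram → List (ℕ × ℕ)
allEndpoints = concatMap endpoints

p : ℕ → Diagram → ℕ
p i D = length (filter (λ e → proj₁ e ≟ i) (allEndpoints D))

_⊕_ : Diagram → Diagram → Diagram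
D ⊕ D' = D ++ map (λ { (x , y , a , b) → (x , y , a + p x D , b + p y D) }) D'

-- rel(X): on each peg, heights of endpoints of X relabelled 1,…,ℓ_i
-- preserving relative order: an endpoint at height h on peg q gets height
-- 1 + #(endpoints of X on peg q with height < h).
relHeight : Diagram → ℕ → ℕ → ℕ
relHeight X q h =
  suc (length (filter (λ e → proj₁ e ≟ q ×-dec proj₂ e <? h) (allEndpoints X)))

rel : Diagram → Diagram
rel X = map (λ { (x , y , a , b) → (x , y , relHeight X x a , relHeight X y b) }) X

-- D_π for π : [n] → [n]  (pegs 1..n+1, heights from 1)
-- e_i = (π(i), n+1, 1, i)
Dπ : {n : ℕ} → (Fin n → Fin n) → Diagram
Dπ {n} π = map (λ i → (suc (toℕ (π i)) , suc n , 1 , suc (toℕ i))) (allFin n)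

-- Colourings.  A colouring of D (listed as e_1,…,e_k) with ℓ colours is a
-- vector c : Vec (Fin ℓ) k (colour of the j-th edge), required surjective.

Surjective : {ℓ k : ℕ} → Vec (Fin ℓ) k → Set
Surjective {ℓ} c = All (λ t → t ∈ toList c) (allFin ℓ)

surjective? : {ℓ k : ℕ} → (c : Vec (Fin ℓ) k) → Dec (Surjective c)
surjective? {ℓ} c = all? (λ t → DecMem._∈?_ FinP._≟_ t (toList c)) (allFin ℓ)

colourClass : {ℓ : ℕ} (D : Diagram) → Vec (Fin ℓ) (length D) → Fin ℓ → Diagram
colourClass D c t =
  map proj₁ (filter (λ ec → proj₂ ec FinP.≟ t) (zip D (toList c)))

𝓡 : {ℓ : ℕ} (D : Diagram) → Vec (Fin ℓ) (length D) → Diagram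
𝓡 {ℓ} D c = foldl _⊕_ [] (map (λ t → rel (colourClass D c t)) (allFin ℓ))

SameDiagram : Diagram → Diagram → Set
SameDiagram A B = All (_∈ B) A × All (_∈ A) B

sameDiagram? : (A B : Diagram) → Dec (SameDiagram A B)
sameDiagram? A B =
  all? (λ e → DecMem._∈?_ _≟E_ e B) A ×-dec all? (λ e → DecMem._∈?_ _≟E_ e A) B

allVecs : (k n : ℕ) → List (Vec (Fin k) n)
allVecs k zero = [] ∷ []
allVecs k (suc n) = concatMap (λ i → map (i ∷_) (allVecs k n)) (allFin k)

f : Diagram → Diagram → ℕ → ℕ
f D₁ D₂ ℓ =
  length (filter (λ c → surjective? c ×-dec sameDiagram? (𝓡 D₁ c) D₂)
                 (allVecs ℓ (length D₁)))

-- M_{D₁,D₂}(x) = Σ_{ℓ≥1} x^ℓ f(D₁,D₂,ℓ), as its coefficient sequence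
Mcoeff : Diagram → Diagram → ℕ → ℕ
Mcoeff D₁ D₂ zero = 0
Mcoeff D₁ D₂ (suc k) = f D₁ D₂ (suc k)

neg1^ : ℕ → ℤ
neg1^ zero = + 1
neg1^ (suc k) = ℤ.- neg1^ k

sumℚ : List ℚ → ℚ
sumℚ = foldr ℚ._+_ 0ℚ

-- R_{D₁,D₂} = Σ_{ℓ≥1} (-1)^{ℓ-1}/ℓ · f(D₁,D₂,ℓ).  The terms with
-- ℓ > |D₁| vanish (no surjection from |D₁| edges onto more colours),
-- so the sum is taken over ℓ = 1 … |D₁|.
Rval : Diagram → Diagram → ℚ
Rval D₁ D₂ =
  sumℚ (map (λ k → (neg1^ k ℤ.* + f D₁ D₂ (suc k)) / suc k) (upTo (length D₁)))

-- 1/d for d ≥ 1 (value 0 at d = 0, never used there)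
recipℕ : ℕ → ℚ
recipℕ zero = 0ℚ
recipℕ (suc d) = + 1 / suc d

descentsFrom : ℕ → List ℕ → ℕ
descentsFrom a [] = 0
descentsFrom a (b ∷ r) = (if Relation.Nullary.does (b <? a) then 1 else 0) + descentsFrom b r

descents : List ℕ → ℕ
descents [] = 0
descents (a ∷ r) = descentsFrom a r

minimal : {n : ℕ} → Permutation′ n → Permutation′ n → ℕ
minimal {n} π σ = suc (descents (map (λ j → toℕ (π ⟨$⟩ˡ (σ ⟨$⟩ʳ j))) (allFin n)))

-- Polynomials with ℕ coefficients as coefficient lists (constant first)

Poly : Set
Poly = List ℕ

_+P_ : Poly → Poly → Poly
[] +P q = q
(a ∷ p') +P [] = a ∷ p'
(a ∷ p') +P (b ∷ q) = (a + b) ∷ (p' +P q)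

scaleP : ℕ → Poly → Poly
scaleP c = map (c *_)

_*P_ : Poly → Poly → Poly
[] *P q = []
(a ∷ p') *P q = scaleP a q +P (0 ∷ (p' *P q))

_^P_ : Poly → ℕ → Poly
q ^P zero = 1 ∷ []
q ^P suc k = q *P (q ^P k)

X^ : ℕ → Poly
X^ m = replicate m 0 ++ (1 ∷ [])

1+X : Poly
1+X = 1 ∷ 1 ∷ []

coeff : Poly → ℕ → ℕ
coeff [] k = 0
coeff (a ∷ q) zero = a
coeff (a ∷ q) (suc k) = coeff q k

-- S_n as the list of injective maps [n] → [n] (given as vectors), used
-- for the traces over W(n) = {D_π : π ∈ S_n}.

permsVec : (n : ℕ) → List (Vec (Fin n) n)
permsVec n = filter (λ v → UniqDec.unique? FinP._≟_ (toList v)) (allVecs n n)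

trR : ℕ → ℚ
trR n = sumℚ (map (λ v → Rval (Dπ (Vec.lookup v)) (Dπ (Vec.lookup v))) (permsVec n))

trMcoeff : ℕ → ℕ → ℕ
trMcoeff n k = sumℕ (map (λ v → Mcoeff (Dπ (Vec.lookup v)) (Dπ (Vec.lookup v)) k) (permsVec n))

module Submission where

-- Fix π, σ and a colouring c of D_π with ℓ colours, and let a = π⁻¹σ.
-- 𝓡(D_π, c) is again a star: the edge from peg π(i) ends at height
-- 1 + rank(i), rank being the position of i in the order "by colour, then by
-- index" (ColouredDiagram).  Hence 𝓡(D_π, c) = D_σ iff this order lists
-- a(0), …, a(n-1) increasingly (RankCriterion), i.e. iff the colour word along
-- a is a staircase: it starts at 0, ends at ℓ-1, and climbs by exactly one at
-- each descent of a and by at most one at each ascent (Staircase).  Counting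
-- staircases gives f(D_π, D_σ, ℓ) = C(n-m, ℓ-m) with m = minimal(π, σ)
-- (ColouringCount), whence M = x^m (1+x)^{n-m} (Polynomials), and R is a Beta
-- integral evaluated in AlternatingSum.

module Counting where

  open import Data.Nat using (ℕ; suc; _+_; _*_; _≤_; _<_; z≤n; s≤s)
  import Data.Nat.Properties as ℕP
  open import Algebra.Properties.CommutativeSemigroup ℕP.+-commutativeSemigroup
    renaming (interchange to +-interchange) using ()
  open import Data.Nat.ListAction renaming (sum to sumℕ)
  open import Data.List using (List; []; _∷_; _++_; map; length; filter; concat)
  import Data.List.Properties as LP
  open import Data.List.Membership.Propositional using (_∈_)
  open import Data.List.Relation.Unary.Any using (here; there)
  import Data.List.Relation.Unary.All as All
  import Data.List.Relation.Binary.Permutation.Propositional as Perm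
  open import Data.List.Relation.Binary.Permutation.Propositional.Properties using (↭-length; filter-↭)
  open import Data.Product using (_×_; _,_; proj₁; proj₂)
  open import Data.Empty using (⊥-elim)
  open import Function using (_∘_)
  open import Relation.Nullary using (Dec; yes; no; ¬_)
  open import Relation.Nullary.Decidable using (_×-dec_; ¬?)
  open import Relation.Unary using (Decidable)
  open import Relation.Binary.PropositionalEquality using (_≡_; refl; sym; trans; cong; module ≡-Reasoning)

  count : {A : Set} {P : A → Set} → Decidable P → List A → ℕ
  count P? xs = length (filter P? xs)

  ind : {P : Set} → Dec P → ℕ → ℕ
  ind (yes _) v = v
  ind (no _) v = 0

  module _ {A : Set} {P : A → Set} (P? : Decidable P) where

    count-yes : ∀ x xs → P x → count P? (x ∷ xs) ≡ suc (count P? xs)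
    count-yes x xs px = cong length (LP.filter-accept P? px)

    count-no : ∀ x xs → ¬ P x → count P? (x ∷ xs) ≡ count P? xs
    count-no x xs ¬px = cong length (LP.filter-reject P? ¬px)

    count-++ : ∀ xs ys → count P? (xs ++ ys) ≡ count P? xs + count P? ys
    count-++ xs ys = trans (cong length (LP.filter-++ P? xs ys)) (LP.length-++ (filter P? xs))

    count-concat : ∀ xss → count P? (concat xss) ≡ sumℕ (map (count P?) xss)
    count-concat [] = refl
    count-concat (xs ∷ xss) =
      trans (count-++ xs (concat xss)) (cong (count P? xs +_) (count-concat xss))

    count-none : ∀ xs → (∀ x → x ∈ xs → ¬ P x) → count P? xs ≡ 0
    count-none [] h = refl
    count-none (x ∷ xs) h =
      trans (count-no x xs (h x (here refl))) (count-none xs (λ y y∈ → h y (there y∈)))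

    count-all : ∀ xs → (∀ x → x ∈ xs → P x) → count P? xs ≡ length xs
    count-all [] h = refl
    count-all (x ∷ xs) h =
      trans (count-yes x xs (h x (here refl))) (cong suc (count-all xs (λ y y∈ → h y (there y∈))))

    count-↭ : ∀ {xs ys} → xs Perm.↭ ys → count P? xs ≡ count P? ys
    count-↭ p = ↭-length (filter-↭ P? p)

  module _ {A : Set} {P Q : A → Set} (P? : Decidable P) (Q? : Decidable Q) where

    count-cong : ∀ xs → (∀ x → x ∈ xs → P x → Q x) → (∀ x → x ∈ xs → Q x → P x) →
      count P? xs ≡ count Q? xs
    count-cong [] f g = refl
    count-cong (x ∷ xs) f g with P? x | Q? x
    ... | yes _ | yes _ = cong suc (count-cong xs (λ y y∈ → f y (there y∈)) (λ y y∈ → g y (there y∈)))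
    ... | yes p | no ¬q = ⊥-elim (¬q (f x (here refl) p))
    ... | no ¬p | yes q = ⊥-elim (¬p (g x (here refl) q))
    ... | no _ | no _ = count-cong xs (λ y y∈ → f y (there y∈)) (λ y y∈ → g y (there y∈))

    count-split : ∀ xs →
      count P? xs ≡ count (λ x → P? x ×-dec Q? x) xs + count (λ x → P? x ×-dec ¬? (Q? x)) xs
    count-split [] = refl
    count-split (x ∷ xs) with P? x | Q? x
    ... | yes _ | yes _ = cong suc (count-split xs)
    ... | yes _ | no _ = trans (cong suc (count-split xs)) (sym (ℕP.+-suc _ _))
    ... | no _ | yes _ = count-split xs
    ... | no _ | no _ = count-split xs

    count-mono : ∀ xs → (∀ x → x ∈ xs → P x → Q x) → count P? xs ≤ count Q? xs
    count-mono [] f = z≤n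
    count-mono (x ∷ xs) f with P? x | Q? x
    ... | yes _ | yes _ = s≤s (count-mono xs (λ y y∈ → f y (there y∈)))
    ... | yes p | no ¬q = ⊥-elim (¬q (f x (here refl) p))
    ... | no _ | yes _ = ℕP.m≤n⇒m≤1+n (count-mono xs (λ y y∈ → f y (there y∈)))
    ... | no _ | no _ = count-mono xs (λ y y∈ → f y (there y∈))

    count-mono-< : ∀ xs → (∀ x → x ∈ xs → P x → Q x) →
      ∀ z → z ∈ xs → Q z → ¬ P z → count P? xs < count Q? xs
    count-mono-< (x ∷ xs) f z (here refl) qz ¬pz with P? x | Q? x
    ... | yes p | _ = ⊥-elim (¬pz p)
    ... | no _ | yes _ = s≤s (count-mono xs (λ y y∈ → f y (there y∈)))
    ... | no _ | no ¬q = ⊥-elim (¬q qz)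
    count-mono-< (x ∷ xs) f z (there z∈) qz ¬pz with P? x | Q? x
    ... | yes _ | yes _ = s≤s (count-mono-< xs (λ y y∈ → f y (there y∈)) z z∈ qz ¬pz)
    ... | yes p | no ¬q = ⊥-elim (¬q (f x (here refl) p))
    ... | no _ | yes _ = ℕP.m≤n⇒m≤1+n (count-mono-< xs (λ y y∈ → f y (there y∈)) z z∈ qz ¬pz)
    ... | no _ | no _ = count-mono-< xs (λ y y∈ → f y (there y∈)) z z∈ qz ¬pz

    private
      PQ? : Decidable (λ x → P x × Q x)
      PQ? x = P? x ×-dec Q? x

    count-filter : ∀ xs → count Q? (filter P? xs) ≡ count (λ x → P? x ×-dec Q? x) xs
    count-filter [] = refl
    count-filter (x ∷ xs) = step (P? x) (Q? x)
      where
      accept : P x → count Q? (filter P? (x ∷ xs)) ≡ count Q? (x ∷ filter P? xs)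
      accept p = cong (count Q?) (LP.filter-accept P? p)
      step : Dec (P x) → Dec (Q x) → count Q? (filter P? (x ∷ xs)) ≡ count PQ? (x ∷ xs)
      step (yes p) (yes q) = trans (accept p) (trans (count-yes Q? x _ q)
        (trans (cong suc (count-filter xs)) (sym (count-yes PQ? x xs (p , q)))))
      step (yes p) (no ¬q) = trans (accept p) (trans (count-no Q? x _ ¬q)
        (trans (count-filter xs) (sym (count-no PQ? x xs (¬q ∘ proj₂)))))
      step (no ¬p) _ = trans (cong (count Q?) (LP.filter-reject P? ¬p))
        (trans (count-filter xs) (sym (count-no PQ? x xs (¬p ∘ proj₁))))

  count-map : {A B : Set} {P : B → Set} (P? : Decidable P) (g : A → B) (xs : List A) →
    count P? (map g xs) ≡ count (λ x → P? (g x)) xs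
  count-map P? g [] = refl
  count-map P? g (x ∷ xs) with P? (g x)
  ... | yes _ = cong suc (count-map P? g xs)
  ... | no _ = count-map P? g xs

  count-and-const : {A D : Set} {Q : A → Set} (d : Dec D) (Q? : Decidable Q) (xs : List A) →
    count (λ x → d ×-dec Q? x) xs ≡ ind d (count Q? xs)
  count-and-const (yes p) Q? xs = count-cong _ Q? xs (λ _ _ pq → proj₂ pq) (λ _ _ q → p , q)
  count-and-const (no ¬p) Q? xs = count-none _ xs (λ _ _ pq → ¬p (proj₁ pq))

  map-cong-∈ : {A B : Set} {f g : A → B} (xs : List A) → (∀ x → x ∈ xs → f x ≡ g x) →
    map f xs ≡ map g xs
  map-cong-∈ xs h = LP.map-cong-local (All.tabulate (λ {x} → h x))

  sum-cong-∈ : {A : Set} {f g : A → ℕ} (xs : List A) → (∀ x → x ∈ xs → f x ≡ g x) →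
    sumℕ (map f xs) ≡ sumℕ (map g xs)
  sum-cong-∈ xs h = cong sumℕ (map-cong-∈ xs h)

  sum-const : {A : Set} (c : ℕ) (xs : List A) → sumℕ (map (λ _ → c) xs) ≡ length xs * c
  sum-const c [] = refl
  sum-const c (x ∷ xs) = cong (c +_) (sum-const c xs)

  sum-+ : {A : Set} (f g : A → ℕ) (xs : List A) →
    sumℕ (map (λ x → f x + g x) xs) ≡ sumℕ (map f xs) + sumℕ (map g xs)
  sum-+ f g [] = refl
  sum-+ f g (x ∷ xs) =
    trans (cong (f x + g x +_) (sum-+ f g xs)) (+-interchange (f x) (g x) (sumℕ (map f xs)) _)

  sum-ind : {A : Set} {Q : A → Set} (Q? : Decidable Q) (c : ℕ) (xs : List A) →
    sumℕ (map (λ x → ind (Q? x) c) xs) ≡ c * count Q? xs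
  sum-ind Q? c [] = sym (ℕP.*-zeroʳ c)
  sum-ind Q? c (x ∷ xs) with Q? x
  ... | yes _ = trans (cong (c +_) (sum-ind Q? c xs)) (sym (ℕP.*-suc c _))
  ... | no _ = sum-ind Q? c xs

  sum-swap : {A B : Set} (xs : List A) (ys : List B) {P : A → B → Set} (P? : ∀ x y → Dec (P x y)) →
    sumℕ (map (λ x → count (P? x) ys) xs) ≡ sumℕ (map (λ y → count (λ x → P? x y) xs) ys)
  sum-swap [] ys P? = trans (sym (ℕP.*-zeroʳ (length ys))) (sym (sum-const 0 ys))
  sum-swap (x ∷ xs) ys P? = begin
      count (P? x) ys + sumℕ (map (λ x → count (P? x) ys) xs)
    ≡⟨ cong (count (P? x) ys +_) (sum-swap xs ys P?) ⟩
      count (P? x) ys + sumℕ (map (λ y → count (λ x → P? x y) xs) ys)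
    ≡⟨ cong (_+ _) (sym (trans (sum-ind (P? x) 1 ys) (ℕP.*-identityˡ _))) ⟩
      sumℕ (map (λ y → ind (P? x y) 1) ys) + sumℕ (map (λ y → count (λ x → P? x y) xs) ys)
    ≡⟨ sym (sum-+ (λ y → ind (P? x y) 1) (λ y → count (λ x → P? x y) xs) ys) ⟩
      sumℕ (map (λ y → ind (P? x y) 1 + count (λ x → P? x y) xs) ys)
    ≡⟨ sum-cong-∈ ys (λ y _ → cons y) ⟩
      sumℕ (map (λ y → count (λ x → P? x y) (x ∷ xs)) ys) ∎
    where
    open ≡-Reasoning
    cons : ∀ y → ind (P? x y) 1 + count (λ x → P? x y) xs ≡ count (λ x → P? x y) (x ∷ xs)
    cons y with P? x y
    ... | yes _ = refl
    ... | no _ = refl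

  filter-map : {A B : Set} {P : B → Set} (P? : Decidable P) (g : A → B) (xs : List A) →
    filter P? (map g xs) ≡ map g (filter (P? ∘ g) xs)
  filter-map P? g [] = refl
  filter-map P? g (x ∷ xs) with P? (g x)
  ... | yes _ = cong (g x ∷_) (filter-map P? g xs)
  ... | no _ = filter-map P? g xs

  filter-cong-∈ : {A : Set} {P Q : A → Set} (P? : Decidable P) (Q? : Decidable Q) (xs : List A) →
    (∀ x → x ∈ xs → P x → Q x) → (∀ x → x ∈ xs → Q x → P x) → filter P? xs ≡ filter Q? xs
  filter-cong-∈ P? Q? [] f g = refl
  filter-cong-∈ P? Q? (x ∷ xs) f g with P? x | Q? x
  ... | yes _ | yes _ =
    cong (x ∷_) (filter-cong-∈ P? Q? xs (λ y y∈ → f y (there y∈)) (λ y y∈ → g y (there y∈)))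
  ... | yes p | no ¬q = ⊥-elim (¬q (f x (here refl) p))
  ... | no ¬p | yes q = ⊥-elim (¬p (g x (here refl) q))
  ... | no _ | no _ = filter-cong-∈ P? Q? xs (λ y y∈ → f y (there y∈)) (λ y y∈ → g y (there y∈))


module Enumeration where

  open import Defs using (allVecs)
  open Counting
  open import Data.Nat using (ℕ; zero; suc; _≤_; z≤n; s≤s; _<?_)
  import Data.Nat.Properties as ℕP
  open import Data.Nat.ListAction renaming (sum to sumℕ)
  open import Data.Fin as Fin using (Fin; toℕ)
  open import Data.Vec as Vec using (Vec; []; _∷_; toList)
  import Data.Vec.Properties as VecP
  open import Data.List as List
    using (List; []; _∷_; _++_; map; concat; allFin; tabulate; applyUpTo; upTo; zip; cartesianProductWith)
  import Data.List.Properties as LP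
  open import Data.List.Membership.Propositional using (_∈_)
  import Data.List.Membership.Propositional.Properties as MemP
  open import Data.List.Relation.Unary.Any using (here)
  open import Data.List.Relation.Unary.Unique.Propositional using (Unique)
  import Data.List.Relation.Unary.Unique.Propositional.Properties as UniqP
  import Data.List.Relation.Unary.AllPairs as AllPairs
  import Data.List.Relation.Unary.All as All
  open import Data.List.Membership.Propositional.Properties.WithK using (unique∧set⇒bag)
  open import Data.List.Relation.Binary.BagAndSetEquality using (∼bag⇒↭)
  open import Function using (_∘_)
  open import Function.Bundles using (mk⇔)
  open import Data.Product using (_,_)
  open import Relation.Unary using (Decidable)
  open import Relation.Binary.PropositionalEquality using (_≡_; refl; sym; trans; cong; subst)

  map-allFin-suc : {A : Set} {n : ℕ} (g : Fin (suc n) → A) →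
    map g (allFin (suc n)) ≡ g Fin.zero ∷ map (g ∘ Fin.suc) (allFin n)
  map-allFin-suc {n = n} g =
    cong (g Fin.zero ∷_) (trans (LP.map-tabulate Fin.suc g) (sym (LP.map-tabulate (λ i → i) (g ∘ Fin.suc))))

  tabulate-toℕ : {A : Set} (n : ℕ) (f : ℕ → A) → tabulate {n = n} (f ∘ toℕ) ≡ applyUpTo f n
  tabulate-toℕ zero f = refl
  tabulate-toℕ (suc n) f = cong (f 0 ∷_) (tabulate-toℕ n (f ∘ suc))

  map-toℕ-allFin : (n : ℕ) → map toℕ (allFin n) ≡ upTo n
  map-toℕ-allFin n = trans (LP.map-tabulate (λ i → i) toℕ) (tabulate-toℕ n (λ k → k))

  toList-lookup : {A : Set} {n : ℕ} (v : Vec A n) → toList v ≡ map (Vec.lookup v) (allFin n)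
  toList-lookup [] = refl
  toList-lookup (x ∷ v) = trans (cong (x ∷_) (toList-lookup v)) (sym (map-allFin-suc (Vec.lookup (x ∷ v))))

  zip-allFin : {A B : Set} {n : ℕ} (g : Fin n → A) (v : Vec B n) →
    zip (map g (allFin n)) (toList v) ≡ map (λ i → (g i , Vec.lookup v i)) (allFin n)
  zip-allFin {n = zero} g [] = refl
  zip-allFin {n = suc n} g (x ∷ v) =
    trans (cong (λ l → zip l (toList (x ∷ v))) (map-allFin-suc g))
      (trans (cong ((g Fin.zero , x) ∷_) (zip-allFin (g ∘ Fin.suc) v))
        (sym (map-allFin-suc (λ i → (g i , Vec.lookup (x ∷ v) i)))))

  zip-map : {A B C : Set} (u : A → B) (w : A → C) (xs : List A) →
    zip (map u xs) (map w xs) ≡ map (λ x → (u x , w x)) xs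
  zip-map u w [] = refl
  zip-map u w (x ∷ xs) = cong ((u x , w x) ∷_) (zip-map u w xs)

  concat-∷ʳ : {A : Set} (xss : List (List A)) (xs : List A) → concat (xss List.∷ʳ xs) ≡ concat xss ++ xs
  concat-∷ʳ xss xs = trans (sym (LP.concat-++ xss (xs ∷ []))) (cong (concat xss ++_) (LP.++-identityʳ xs))

  allVecs-suc : ∀ k n → allVecs k (suc n) ≡ cartesianProductWith _∷_ (allFin k) (allVecs k n)
  allVecs-suc k n = go (allFin k)
    where
    go : (xs : List (Fin k)) →
      List.concatMap (λ i → map (i ∷_) (allVecs k n)) xs ≡ cartesianProductWith _∷_ xs (allVecs k n)
    go [] = refl
    go (x ∷ xs) = cong (map (x ∷_) (allVecs k n) ++_) (go xs)

  allVecs-unique : ∀ k n → Unique (allVecs k n)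
  allVecs-unique k zero = All.[] AllPairs.∷ AllPairs.[]
  allVecs-unique k (suc n) = subst Unique (sym (allVecs-suc k n))
    (UniqP.cartesianProductWith⁺ _∷_ VecP.∷-injective (UniqP.allFin⁺ k) (allVecs-unique k n))

  allVecs-complete : ∀ k n (v : Vec (Fin k) n) → v ∈ allVecs k n
  allVecs-complete k zero [] = here refl
  allVecs-complete k (suc n) (x ∷ v) = subst ((x ∷ v) ∈_) (sym (allVecs-suc k n))
    (MemP.∈-cartesianProductWith⁺ _∷_ (MemP.∈-allFin x) (allVecs-complete k n v))

  count-allVecs-suc : ∀ k n {Q : Vec (Fin k) (suc n) → Set} (Q? : Decidable Q) →
    count Q? (allVecs k (suc n)) ≡ sumℕ (map (λ i → count (Q? ∘ (i ∷_)) (allVecs k n)) (allFin k))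
  count-allVecs-suc k n Q? =
    trans (count-concat Q? (map (λ i → map (i ∷_) (allVecs k n)) (allFin k)))
      (trans (cong sumℕ (sym (LP.map-∘ (allFin k))))
        (sum-cong-∈ (allFin k) (λ i _ → count-map Q? (i ∷_) (allVecs k n))))

  count-set : {A : Set} {P : A → Set} (P? : Decidable P) {xs ys : List A} → Unique xs → Unique ys →
    (∀ x → x ∈ xs → x ∈ ys) → (∀ x → x ∈ ys → x ∈ xs) → count P? xs ≡ count P? ys
  count-set P? ux uy f g = count-↭ P? (∼bag⇒↭ (unique∧set⇒bag ux uy (λ {x} → mk⇔ (f x) (g x))))

  count-bij : {A : Set} {xs : List A} {P : A → Set} (P? : Decidable P) →
    Unique xs → (∀ x → x ∈ xs) → (g h : A → A) → (∀ x → g (h x) ≡ x) → (∀ x → h (g x) ≡ x) →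
    count (P? ∘ g) xs ≡ count P? xs
  count-bij {xs = xs} P? u complete g h gh hg =
    trans (sym (count-map P? g xs))
      (count-set P? (UniqP.map⁺ g-inj u) u (λ x _ → complete x)
        (λ x _ → subst (_∈ map g xs) (gh x) (MemP.∈-map⁺ g (complete (h x)))))
    where
    g-inj : ∀ {x y} → g x ≡ g y → x ≡ y
    g-inj {x} {y} eq = trans (sym (hg x)) (trans (cong h eq) (hg y))

  count-allVecs-bij : ∀ {k n} {P : Vec (Fin k) n → Set} (P? : Decidable P) (g h : Vec (Fin k) n → Vec (Fin k) n) →
    (∀ v → g (h v) ≡ v) → (∀ v → h (g v) ≡ v) → count (P? ∘ g) (allVecs k n) ≡ count P? (allVecs k n)
  count-allVecs-bij {k} {n} P? = count-bij P? (allVecs-unique k n) (allVecs-complete k n)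

  count-allFin-bij : ∀ {n} {P : Fin n → Set} (P? : Decidable P) (g h : Fin n → Fin n) →
    (∀ i → g (h i) ≡ i) → (∀ i → h (g i) ≡ i) → count (P? ∘ g) (allFin n) ≡ count P? (allFin n)
  count-allFin-bij {n} P? = count-bij P? (UniqP.allFin⁺ n) MemP.∈-allFin

  count-allVecs-length : ∀ {k} {Q : List (Fin k) → Set} (Q? : Decidable Q) {L₁ L₂ : ℕ} → L₁ ≡ L₂ →
    count (Q? ∘ toList {n = L₁}) (allVecs k L₁) ≡ count (Q? ∘ toList {n = L₂}) (allVecs k L₂)
  count-allVecs-length Q? refl = refl

  count-<-allFin : ∀ N k → k ≤ N → count (λ (j : Fin N) → toℕ j <? k) (allFin N) ≡ k
  count-<-allFin N zero _ = count-none _ (allFin N) (λ _ _ ())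
  count-<-allFin (suc N) (suc k) (s≤s k≤N) =
    trans (count-yes (λ (j : Fin (suc N)) → toℕ j <? suc k) Fin.zero (List.tabulate Fin.suc) (s≤s z≤n))
      (cong suc (trans (cong (count (λ (j : Fin (suc N)) → toℕ j <? suc k)) (sym (LP.map-tabulate (λ x → x) Fin.suc)))
        (trans (count-map (λ (j : Fin (suc N)) → toℕ j <? suc k) Fin.suc (allFin N))
          (trans (count-cong _ _ (allFin N) (λ _ _ p → ℕP.≤-pred p) (λ _ _ q → s≤s q))
            (count-<-allFin N k k≤N)))))


module Polynomials where

  -- The shifted binomial coefficients binomShift F G r = C(F, r - G) (zero for
  -- r < G) are the coefficients of x^G (1+x)^F; they obey Pascal's rule in F.

  open import Defs using (_+P_; scaleP; _*P_; _^P_; X^; 1+X; coeff)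
  open import Data.Nat using (ℕ; zero; suc; _+_; _*_)
  import Data.Nat.Properties as ℕP
  open import Data.Nat.Combinatorics using (_C_; nCk+nC[k+1]≡[n+1]C[k+1])
  open import Data.List using ([]; _∷_)
  open import Relation.Binary.PropositionalEquality using (_≡_; refl; sym; trans; cong; cong₂; module ≡-Reasoning)

  binomShift : ℕ → ℕ → ℕ → ℕ
  binomShift F zero r = F C r
  binomShift F (suc G) zero = 0
  binomShift F (suc G) (suc r) = binomShift F G r

  binomShift-pascal₀ : ∀ F G → binomShift (suc F) G 0 ≡ binomShift F G 0
  binomShift-pascal₀ F zero = refl
  binomShift-pascal₀ F (suc G) = refl

  binomShift-pascal : ∀ F G r → binomShift (suc F) G (suc r) ≡ binomShift F G (suc r) + binomShift F G r
  binomShift-pascal F zero r = trans (sym (nCk+nC[k+1]≡[n+1]C[k+1] F r)) (ℕP.+-comm (F C r) (F C suc r))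
  binomShift-pascal F (suc G) zero = trans (binomShift-pascal₀ F G) (sym (ℕP.+-identityʳ _))
  binomShift-pascal F (suc G) (suc r) = binomShift-pascal F G r

  coeff-+P : ∀ p q k → coeff (p +P q) k ≡ coeff p k + coeff q k
  coeff-+P [] q k = refl
  coeff-+P (a ∷ p) [] zero = sym (ℕP.+-identityʳ a)
  coeff-+P (a ∷ p) [] (suc k) = sym (ℕP.+-identityʳ _)
  coeff-+P (a ∷ p) (b ∷ q) zero = refl
  coeff-+P (a ∷ p) (b ∷ q) (suc k) = coeff-+P p q k

  coeff-scaleP : ∀ a q k → coeff (scaleP a q) k ≡ a * coeff q k
  coeff-scaleP a [] k = sym (ℕP.*-zeroʳ a)
  coeff-scaleP a (b ∷ q) zero = refl
  coeff-scaleP a (b ∷ q) (suc k) = coeff-scaleP a q k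

  coeff-X^0 : ∀ q k → coeff (X^ 0 *P q) k ≡ coeff q k
  coeff-X^0 q k = trans (coeff-+P (scaleP 1 q) (0 ∷ []) k)
    (trans (cong₂ _+_ (trans (coeff-scaleP 1 q k) (ℕP.*-identityˡ _)) (coeff-zero k)) (ℕP.+-identityʳ _))
    where
    coeff-zero : ∀ k → coeff (0 ∷ []) k ≡ 0
    coeff-zero zero = refl
    coeff-zero (suc k) = refl

  coeff-X^suc : ∀ m q k → coeff (X^ (suc m) *P q) k ≡ coeff (0 ∷ (X^ m *P q)) k
  coeff-X^suc m q k = trans (coeff-+P (scaleP 0 q) (0 ∷ (X^ m *P q)) k)
    (cong (_+ coeff (0 ∷ (X^ m *P q)) k) (coeff-scaleP 0 q k))

  coeff-1+X*P : ∀ r k → coeff (1+X *P r) k ≡ coeff r k + coeff (0 ∷ r) k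
  coeff-1+X*P r k = begin
      coeff (scaleP 1 r +P (0 ∷ (X^ 0 *P r))) k
    ≡⟨ coeff-+P (scaleP 1 r) (0 ∷ (X^ 0 *P r)) k ⟩
      coeff (scaleP 1 r) k + coeff (0 ∷ (X^ 0 *P r)) k
    ≡⟨ cong₂ _+_ (trans (coeff-scaleP 1 r k) (ℕP.*-identityˡ _)) (shifted k) ⟩
      coeff r k + coeff (0 ∷ r) k ∎
    where
    open ≡-Reasoning
    shifted : ∀ k → coeff (0 ∷ (X^ 0 *P r)) k ≡ coeff (0 ∷ r) k
    shifted zero = refl
    shifted (suc j) = coeff-X^0 r j

  coeff-binomial : ∀ N j → coeff (1+X ^P N) j ≡ N C j
  coeff-binomial zero zero = refl
  coeff-binomial zero (suc j) = refl
  coeff-binomial (suc N) zero =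
    trans (coeff-1+X*P (1+X ^P N) 0) (trans (ℕP.+-identityʳ _) (coeff-binomial N 0))
  coeff-binomial (suc N) (suc j) = begin
      coeff (1+X *P (1+X ^P N)) (suc j)
    ≡⟨ coeff-1+X*P (1+X ^P N) (suc j) ⟩
      coeff (1+X ^P N) (suc j) + coeff (1+X ^P N) j
    ≡⟨ cong₂ _+_ (coeff-binomial N (suc j)) (coeff-binomial N j) ⟩
      N C suc j + N C j
    ≡⟨ ℕP.+-comm (N C suc j) (N C j) ⟩
      N C j + N C suc j
    ≡⟨ nCk+nC[k+1]≡[n+1]C[k+1] N j ⟩
      suc N C suc j ∎
    where open ≡-Reasoning

  coeff-binomShift : ∀ F G r → coeff (X^ G *P (1+X ^P F)) r ≡ binomShift F G r
  coeff-binomShift F zero r = trans (coeff-X^0 (1+X ^P F) r) (coeff-binomial F r)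
  coeff-binomShift F (suc G) zero = coeff-X^suc G (1+X ^P F) zero
  coeff-binomShift F (suc G) (suc r) = trans (coeff-X^suc G (1+X ^P F) (suc r)) (coeff-binomShift F G r)


module ColouredDiagram where

  -- For a colouring c of D_π, the diagram 𝓡(D_π, c) is again a "star" on the
  -- top peg n+1: its edge starting at peg π(i) ends at height 1 + rank(i), where
  -- rank(i) is the position of i when [n] is ordered by (colour, index).
  -- Indeed rel(D_c(t)) relabels the top heights of the edges of colour t by
  -- their order among themselves, and the sum ⊕ stacks colour t above all
  -- #{j | c(j) < t} edges of smaller colour, while each bottom peg carries one
  -- edge only.

  open import Defs
  open Counting
  open Enumeration
  open import Data.Nat using (ℕ; zero; suc; _+_; _<_; s≤s; _<?_; _≟_)
  import Data.Nat.Properties as ℕP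
  open import Data.Nat.ListAction renaming (sum to sumℕ)
  open import Data.Fin as Fin using (Fin; toℕ)
  import Data.Fin.Properties as FinP
  open import Data.Vec as Vec using (Vec; toList)
  open import Data.List as List using (List; []; _∷_; _++_; map; length; filter; concat; allFin; upTo; zip; foldl)
  import Data.List.Properties as LP
  open import Data.List.Membership.Propositional using (_∈_)
  open import Data.List.Relation.Unary.Any using (here; there)
  import Data.List.Membership.Propositional.Properties as MemP
  open import Data.Product using (_×_; _,_; proj₁; proj₂; ∃)
  open import Relation.Nullary using (Dec; yes; no)
  open import Relation.Nullary.Decidable using (_×-dec_)
  open import Relation.Unary using (Decidable)
  open import Relation.Binary.PropositionalEquality
    using (_≡_; _≢_; refl; sym; trans; cong; cong₂; subst; module ≡-Reasoning)

  colourClassˡ : {ℓ : ℕ} → Diagram → List (Fin ℓ) → Fin ℓ → Diagram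
  colourClassˡ D cs t = map proj₁ (filter (λ ec → proj₂ ec FinP.≟ t) (zip D cs))

  𝓡ˡ : {ℓ : ℕ} → Diagram → List (Fin ℓ) → Diagram
  𝓡ˡ {ℓ} D cs = foldl _⊕_ [] (map (λ t → rel (colourClassˡ D cs t)) (allFin ℓ))

  count-allEndpoints : {I : Set} {P : ℕ × ℕ → Set} (P? : Decidable P) (edge : I → Edge) (is : List I) →
    count P? (allEndpoints (map edge is)) ≡ sumℕ (map (λ i → count P? (endpoints (edge i))) is)
  count-allEndpoints P? edge [] = refl
  count-allEndpoints P? edge (i ∷ is) =
    trans (count-++ P? (endpoints (edge i)) (allEndpoints (map edge is)))
      (cong (count P? (endpoints (edge i)) +_) (count-allEndpoints P? edge is))

  module Colouring (n : ℕ) (π : Fin n → Fin n) (π-inj : ∀ {i j} → π i ≡ π j → i ≡ j)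
                   (ℓ : ℕ) (c : Vec (Fin ℓ) n) where

    col : Fin n → Fin ℓ
    col = Vec.lookup c

    colour : Fin n → ℕ
    colour i = toℕ (col i)

    peg : Fin n → ℕ
    peg i = suc (toℕ (π i))

    edge : Fin n → Edge
    edge i = (peg i , suc n , 1 , suc (toℕ i))

    peg≢top : ∀ i → peg i ≢ suc n
    peg≢top i eq = ℕP.<⇒≢ (FinP.toℕ<n (π i)) (ℕP.suc-injective eq)

    ofColour : ℕ → List (Fin n)
    ofColour t = filter (λ i → colour i ≟ t) (allFin n)

    #colourBelow : ℕ → ℕ
    #colourBelow t = count (λ j → colour j <? t) (allFin n)

    #earlierOfColour : ℕ → Fin n → ℕ
    #earlierOfColour t i = count (λ j → toℕ j <? toℕ i) (ofColour t)

    -- position of i in the lexicographic order by (colour, index)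
    rank : Fin n → ℕ
    rank i = #earlierOfColour (colour i) i + #colourBelow (colour i)

    rankedEdge : Fin n → Edge
    rankedEdge i = (peg i , suc n , 1 , suc (rank i))

    𝓡c : Diagram
    𝓡c = 𝓡ˡ (map edge (allFin n)) (toList c)

    colourClass-edges : ∀ (t : Fin ℓ) →
      colourClassˡ (map edge (allFin n)) (toList c) t ≡ map edge (ofColour (toℕ t))
    colourClass-edges t = begin
        map proj₁ (filter (λ ec → proj₂ ec FinP.≟ t) (zip (map edge (allFin n)) (toList c)))
      ≡⟨ cong (λ l → map proj₁ (filter (λ ec → proj₂ ec FinP.≟ t) l)) (zip-allFin edge c) ⟩
        map proj₁ (filter (λ ec → proj₂ ec FinP.≟ t) (map edgeCol (allFin n)))
      ≡⟨ cong (map proj₁) (filter-map (λ ec → proj₂ ec FinP.≟ t) edgeCol (allFin n)) ⟩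
        map proj₁ (map edgeCol (filter (λ i → col i FinP.≟ t) (allFin n)))
      ≡⟨ sym (LP.map-∘ (filter (λ i → col i FinP.≟ t) (allFin n))) ⟩
        map edge (filter (λ i → col i FinP.≟ t) (allFin n))
      ≡⟨ cong (map edge) (filter-cong-∈ (λ i → col i FinP.≟ t) (λ i → colour i ≟ toℕ t) (allFin n)
           (λ i _ → cong toℕ) (λ i _ → FinP.toℕ-injective)) ⟩
        map edge (ofColour (toℕ t)) ∎
      where
      open ≡-Reasoning
      edgeCol : Fin n → Edge × Fin ℓ
      edgeCol i = (edge i , col i)

    module _ (is : List (Fin n)) where

      relHeight-bottom : ∀ q → relHeight (map edge is) q 1 ≡ 1
      relHeight-bottom q = cong suc (begin
          count below1? (allEndpoints (map edge is))
        ≡⟨ count-allEndpoints below1? edge is ⟩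
          sumℕ (map (λ j → count below1? (endpoints (edge j))) is)
        ≡⟨ sum-cong-∈ is (λ j _ → none j) ⟩
          sumℕ (map (λ _ → 0) is)
        ≡⟨ trans (sum-const 0 is) (ℕP.*-zeroʳ (length is)) ⟩
          0 ∎)
        where
        open ≡-Reasoning
        below1? : (ep : ℕ × ℕ) → Dec (proj₁ ep ≡ q × proj₂ ep < 1)
        below1? ep = proj₁ ep ≟ q ×-dec proj₂ ep <? 1
        none : ∀ j → count below1? (endpoints (edge j)) ≡ 0
        none j = count-none below1? (endpoints (edge j))
          (λ { _ (here refl) (_ , s≤s ()) ; _ (there (here refl)) (_ , s≤s ()) })

      relHeight-top : (i : Fin n) →
        relHeight (map edge is) (suc n) (suc (toℕ i)) ≡ suc (count (λ (j : Fin n) → toℕ j <? toℕ i) is)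
      relHeight-top i = cong suc (begin
          count below? (allEndpoints (map edge is))
        ≡⟨ count-allEndpoints below? edge is ⟩
          sumℕ (map (λ j → count below? (endpoints (edge j))) is)
        ≡⟨ sum-cong-∈ is (λ j _ → single j (toℕ j <? toℕ i)) ⟩
          sumℕ (map (λ j → ind (toℕ j <? toℕ i) 1) is)
        ≡⟨ trans (sum-ind (λ (j : Fin n) → toℕ j <? toℕ i) 1 is) (ℕP.*-identityˡ _) ⟩
          count (λ (j : Fin n) → toℕ j <? toℕ i) is ∎)
        where
        open ≡-Reasoning
        below? : (ep : ℕ × ℕ) → Dec (proj₁ ep ≡ suc n × proj₂ ep < suc (toℕ i))
        below? ep = proj₁ ep ≟ suc n ×-dec proj₂ ep <? suc (toℕ i)
        single : ∀ j (d : Dec (toℕ j < toℕ i)) → count below? (endpoints (edge j)) ≡ ind d 1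
        single j d = trans (count-no below? (peg j , 1) _ (λ p → peg≢top j (proj₁ p))) (top d)
          where
          top : (d : Dec (toℕ j < toℕ i)) → count below? ((suc n , suc (toℕ j)) ∷ []) ≡ ind d 1
          top (yes lt) = count-yes below? (suc n , suc (toℕ j)) [] (refl , s≤s lt)
          top (no nlt) = count-no below? (suc n , suc (toℕ j)) [] (λ p → nlt (ℕP.≤-pred (proj₂ p)))

      rel-edges : rel (map edge is) ≡
        map (λ (i : Fin n) → (peg i , suc n , 1 , suc (count (λ (j : Fin n) → toℕ j <? toℕ i) is))) is
      rel-edges = trans (sym (LP.map-∘ is))
        (map-cong-∈ is (λ i _ → cong₂ (λ a b → (peg i , suc n , a , b))
                                       (relHeight-bottom (peg i)) (relHeight-top i)))

    relClass : ℕ → Diagram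
    relClass t = map (λ i → (peg i , suc n , 1 , suc (#earlierOfColour t i))) (ofColour t)

    relClasses : map (λ t → rel (colourClassˡ (map edge (allFin n)) (toList c) t)) (allFin ℓ) ≡ map relClass (upTo ℓ)
    relClasses =
      trans (LP.map-cong (λ t → trans (cong rel (colourClass-edges t)) (rel-edges (ofColour (toℕ t)))) (allFin ℓ))
      (trans (LP.map-∘ (allFin ℓ)) (cong (map relClass) (map-toℕ-allFin ℓ)))

    prefix : ℕ → List (Fin n)
    prefix t = concat (map ofColour (upTo t))

    prefix-suc : ∀ t → prefix (suc t) ≡ prefix t ++ ofColour t
    prefix-suc t = begin
        concat (map ofColour (upTo (suc t)))
      ≡⟨ cong (λ l → concat (map ofColour l)) (sym (LP.upTo-∷ʳ t)) ⟩
        concat (map ofColour (upTo t List.∷ʳ t))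
      ≡⟨ cong concat (LP.map-++ ofColour (upTo t) (t ∷ [])) ⟩
        concat (map ofColour (upTo t) List.∷ʳ ofColour t)
      ≡⟨ concat-∷ʳ (map ofColour (upTo t)) (ofColour t) ⟩
        prefix t ++ ofColour t ∎
      where open ≡-Reasoning

    ∈ofColour⁻ : ∀ {t j} → j ∈ ofColour t → colour j ≡ t
    ∈ofColour⁻ {t} j∈ = proj₂ (MemP.∈-filter⁻ (λ i → colour i ≟ t) {xs = allFin n} j∈)

    ∈prefix⁻ : ∀ t j → j ∈ prefix t → colour j < t
    ∈prefix⁻ t j j∈ with MemP.∈-concat⁻′ (map ofColour (upTo t)) j∈
    ... | js , j∈js , js∈ with MemP.∈-map⁻ ofColour js∈
    ... | t' , t'∈ , refl = subst (_< t) (sym (∈ofColour⁻ j∈js)) (MemP.∈-upTo⁻ t'∈)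

    #colourBelow-suc : ∀ t → #colourBelow (suc t) ≡ #colourBelow t + length (ofColour t)
    #colourBelow-suc t = trans (count-split (λ j → colour j <? suc t) (λ j → colour j <? t) (allFin n))
      (cong₂ _+_ (count-cong _ _ (allFin n) (λ _ _ p → proj₂ p) (λ _ _ q → ℕP.m<n⇒m<1+n q , q))
                 (count-cong _ _ (allFin n)
                    (λ _ _ p → ℕP.≤-antisym (ℕP.≤-pred (proj₁ p)) (ℕP.≮⇒≥ (proj₂ p)))
                    (λ _ _ q → ℕP.≤-reflexive (cong suc q) , ℕP.<-irrefl q)))

    length-prefix : ∀ t → length (prefix t) ≡ #colourBelow t
    length-prefix zero = sym (count-none _ (allFin n) (λ _ _ ()))
    length-prefix (suc t) = begin
        length (prefix (suc t))
      ≡⟨ cong length (prefix-suc t) ⟩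
        length (prefix t ++ ofColour t)
      ≡⟨ LP.length-++ (prefix t) ⟩
        length (prefix t) + length (ofColour t)
      ≡⟨ cong (_+ length (ofColour t)) (length-prefix t) ⟩
        #colourBelow t + length (ofColour t)
      ≡⟨ sym (#colourBelow-suc t) ⟩
        #colourBelow (suc t) ∎
      where open ≡-Reasoning

    -- Stacking the class of colour t on the classes of smaller colour: the top
    -- peg already carries #colourBelow t endpoints, the bottom pegs of colour t
    -- none, so the class of colour t is shifted into its ranked position.
    module _ (t : ℕ) where
      private
        below : Diagram
        below = map rankedEdge (prefix t)

      #top-below : p (suc n) below ≡ #colourBelow t
      #top-below = begin
          count atTop? (allEndpoints below)
        ≡⟨ count-allEndpoints atTop? rankedEdge (prefix t) ⟩
          sumℕ (map (λ j → count atTop? (endpoints (rankedEdge j))) (prefix t))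
        ≡⟨ sum-cong-∈ (prefix t) (λ j _ → one j) ⟩
          sumℕ (map (λ _ → 1) (prefix t))
        ≡⟨ trans (sum-const 1 (prefix t)) (ℕP.*-identityʳ _) ⟩
          length (prefix t)
        ≡⟨ length-prefix t ⟩
          #colourBelow t ∎
        where
        open ≡-Reasoning
        atTop? : (ep : ℕ × ℕ) → Dec (proj₁ ep ≡ suc n)
        atTop? ep = proj₁ ep ≟ suc n
        one : ∀ j → count atTop? (endpoints (rankedEdge j)) ≡ 1
        one j = trans (count-no atTop? (peg j , 1) _ (peg≢top j)) (count-yes atTop? (suc n , suc (rank j)) [] refl)

      #peg-below : ∀ i → colour i ≡ t → p (peg i) below ≡ 0
      #peg-below i ci≡t = trans (count-allEndpoints atPeg? rankedEdge (prefix t))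
        (trans (sum-cong-∈ (prefix t) none) (trans (sum-const 0 (prefix t)) (ℕP.*-zeroʳ (length (prefix t)))))
        where
        atPeg? : (ep : ℕ × ℕ) → Dec (proj₁ ep ≡ peg i)
        atPeg? ep = proj₁ ep ≟ peg i
        none : ∀ j → j ∈ prefix t → count atPeg? (endpoints (rankedEdge j)) ≡ 0
        none j j∈ = trans (count-no atPeg? (peg j , 1) _ peg-j≢peg-i)
                          (count-no atPeg? (suc n , suc (rank j)) [] (λ eq → peg≢top i (sym eq)))
          where
          peg-j≢peg-i : peg j ≢ peg i
          peg-j≢peg-i eq with π-inj (FinP.toℕ-injective (ℕP.suc-injective eq))
          ... | refl = ℕP.<-irrefl ci≡t (∈prefix⁻ t j j∈)

      shift-relClass : map (λ { (x , y , a , b) → (x , y , a + p x below , b + p y below) }) (relClass t)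
                       ≡ map rankedEdge (ofColour t)
      shift-relClass = trans (sym (LP.map-∘ (ofColour t))) (map-cong-∈ (ofColour t) shifted)
        where
        shifted : ∀ i → i ∈ ofColour t →
          (peg i , suc n , 1 + p (peg i) below , suc (#earlierOfColour t i) + p (suc n) below) ≡ rankedEdge i
        shifted i i∈ =
          trans (cong₂ (λ a b → (peg i , suc n , a , b))
                       (cong (1 +_) (#peg-below i ci≡t)) (cong (suc (#earlierOfColour t i) +_) #top-below))
                (cong (λ s → (peg i , suc n , 1 , suc (#earlierOfColour s i + #colourBelow s))) (sym ci≡t))
          where
          ci≡t : colour i ≡ t
          ci≡t = ∈ofColour⁻ i∈

    fold-relClasses : ∀ t → foldl _⊕_ [] (map relClass (upTo t)) ≡ map rankedEdge (prefix t)
    fold-relClasses zero = refl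
    fold-relClasses (suc t) = begin
        foldl _⊕_ [] (map relClass (upTo (suc t)))
      ≡⟨ cong (λ l → foldl _⊕_ [] (map relClass l)) (sym (LP.upTo-∷ʳ t)) ⟩
        foldl _⊕_ [] (map relClass (upTo t List.∷ʳ t))
      ≡⟨ cong (foldl _⊕_ []) (LP.map-++ relClass (upTo t) (t ∷ [])) ⟩
        foldl _⊕_ [] (map relClass (upTo t) List.∷ʳ relClass t)
      ≡⟨ LP.foldl-∷ʳ _⊕_ [] (relClass t) (map relClass (upTo t)) ⟩
        foldl _⊕_ [] (map relClass (upTo t)) ⊕ relClass t
      ≡⟨ cong (_⊕ relClass t) (fold-relClasses t) ⟩
        map rankedEdge (prefix t) ⊕ relClass t
      ≡⟨ cong (map rankedEdge (prefix t) ++_) (shift-relClass t) ⟩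
        map rankedEdge (prefix t) ++ map rankedEdge (ofColour t)
      ≡⟨ sym (LP.map-++ rankedEdge (prefix t) (ofColour t)) ⟩
        map rankedEdge (prefix t ++ ofColour t)
      ≡⟨ cong (map rankedEdge) (sym (prefix-suc t)) ⟩
        map rankedEdge (prefix (suc t)) ∎
      where open ≡-Reasoning

    𝓡c-ranked : 𝓡c ≡ map rankedEdge (prefix ℓ)
    𝓡c-ranked = trans (cong (foldl _⊕_ []) relClasses) (fold-relClasses ℓ)

    rankedEdge∈𝓡c : ∀ i → rankedEdge i ∈ 𝓡c
    rankedEdge∈𝓡c i = subst (rankedEdge i ∈_) (sym 𝓡c-ranked)
      (MemP.∈-map⁺ rankedEdge
        (MemP.∈-concat⁺′ (MemP.∈-filter⁺ (λ k → colour k ≟ colour i) (MemP.∈-allFin i) refl)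
         (MemP.∈-map⁺ ofColour (MemP.∈-upTo⁺ (FinP.toℕ<n (col i))))))

    ∈𝓡c⁻ : ∀ x → x ∈ 𝓡c → ∃ λ i → x ≡ rankedEdge i
    ∈𝓡c⁻ x x∈ with MemP.∈-map⁻ rankedEdge (subst (x ∈_) 𝓡c-ranked x∈)
    ... | i , _ , eq = i , eq


module RankCriterion where

  -- Write π = σ ∘ τ with τ a bijection with inverse a
  -- (for permutations τ = σ⁻¹π and a = π⁻¹σ).  Since 𝓡(D_π, c) has the edge
  -- (π(i), n+1, 1, 1 + rank(i)) and D_σ the edge (σ(τ i), n+1, 1, 1 + τ(i)),
  -- the two agree iff rank = τ.  As rank(i) counts the predecessors of i in the
  -- strict order ≺ "by colour, then by index", this happens iff ≺ lists
  -- a(0), a(1), …, a(n-1) in increasing order, i.e. iff a(j) ≺ a(j+1) for all j.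

  open import Defs
  open Counting
  open Enumeration
  open ColouredDiagram
  open import Data.Nat using (ℕ; zero; suc; _+_; _∸_; _≤_; _<_; _<?_; _≟_)
  import Data.Nat.Properties as ℕP
  open import Data.Fin as Fin using (Fin; toℕ)
  import Data.Fin.Properties as FinP
  open import Data.Vec using (Vec)
  open import Data.List as List using (allFin)
  open import Data.List.Membership.Propositional using (_∈_)
  import Data.List.Membership.Propositional.Properties as MemP
  import Data.List.Relation.Unary.All as All
  open import Data.Product using (_×_; _,_; proj₁; proj₂)
  open import Data.Sum using (_⊎_; inj₁; inj₂)
  open import Data.Empty using (⊥-elim)
  open import Relation.Nullary using (Dec; ¬_)
  open import Relation.Nullary.Decidable using (_×-dec_; _⊎-dec_)
  open import Relation.Binary.Definitions using (tri<; tri≈; tri>)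
  open import Relation.Binary.PropositionalEquality using (_≡_; refl; sym; trans; cong; cong₂; subst; subst₂)

  record Factorisation (n : ℕ) : Set where
    field
      π σ τ a : Fin n → Fin n
      σ-inj : ∀ {i j} → σ i ≡ σ j → i ≡ j
      τ∘a : ∀ j → τ (a j) ≡ j
      a∘τ : ∀ i → a (τ i) ≡ i
      σ∘τ : ∀ i → σ (τ i) ≡ π i

    π-inj : ∀ {i j} → π i ≡ π j → i ≡ j
    π-inj {i} {j} eq =
      trans (sym (a∘τ i)) (trans (cong a (σ-inj (trans (σ∘τ i) (trans eq (sym (σ∘τ j)))))) (a∘τ j))

    a-inj : ∀ {i j} → a i ≡ a j → i ≡ j
    a-inj {i} {j} eq = trans (sym (τ∘a i)) (trans (cong τ eq) (τ∘a j))

  module Criterion {n : ℕ} (φ : Factorisation n) (ℓ : ℕ) (c : Vec (Fin ℓ) n) where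
    open Factorisation φ
    open Colouring n π π-inj ℓ c public

    σ-edge : Fin n → Edge
    σ-edge j = (suc (toℕ (σ j)) , suc n , 1 , suc (toℕ j))

    rank≡τ-of-𝓡c≈Dσ : SameDiagram 𝓡c (Dπ σ) → ∀ i → rank i ≡ toℕ (τ i)
    rank≡τ-of-𝓡c≈Dσ (𝓡c⊆Dσ , _) i with MemP.∈-map⁻ σ-edge (All.lookup 𝓡c⊆Dσ (rankedEdge∈𝓡c i))
    ... | j , _ , eq = trans (ℕP.suc-injective (cong (λ x → proj₂ (proj₂ (proj₂ x))) eq)) (cong toℕ j≡τi)
      where
      πi≡σj : π i ≡ σ j
      πi≡σj = FinP.toℕ-injective (ℕP.suc-injective (cong proj₁ eq))
      j≡τi : j ≡ τ i
      j≡τi = σ-inj (trans (sym πi≡σj) (sym (σ∘τ i)))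

    𝓡c≈Dσ-of-rank≡τ : (∀ i → rank i ≡ toℕ (τ i)) → SameDiagram 𝓡c (Dπ σ)
    𝓡c≈Dσ-of-rank≡τ rank≡τ = All.tabulate 𝓡c⊆Dσ , All.tabulate Dσ⊆𝓡c
      where
      𝓡c⊆Dσ : ∀ {x} → x ∈ 𝓡c → x ∈ Dπ σ
      𝓡c⊆Dσ {x} x∈ with ∈𝓡c⁻ x x∈
      ... | i , refl = subst (_∈ Dπ σ)
        (cong₂ (λ u v → (suc (toℕ u) , suc n , 1 , suc v)) (σ∘τ i) (sym (rank≡τ i)))
        (MemP.∈-map⁺ σ-edge (MemP.∈-allFin (τ i)))
      Dσ⊆𝓡c : ∀ {y} → y ∈ Dπ σ → y ∈ 𝓡c
      Dσ⊆𝓡c {y} y∈ with MemP.∈-map⁻ σ-edge y∈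
      ... | j , _ , refl = subst (_∈ 𝓡c)
        (cong₂ (λ u v → (suc (toℕ u) , suc n , 1 , suc v)) (trans (sym (σ∘τ (a j))) (cong σ (τ∘a j)))
          (trans (rank≡τ (a j)) (cong toℕ (τ∘a j))))
        (rankedEdge∈𝓡c (a j))

    _≺_ : Fin n → Fin n → Set
    j ≺ i = colour j < colour i ⊎ (colour j ≡ colour i × toℕ j < toℕ i)

    _≺?_ : ∀ j i → Dec (j ≺ i)
    j ≺? i = (colour j <? colour i) ⊎-dec ((colour j ≟ colour i) ×-dec (toℕ j <? toℕ i))

    ≺-irrefl : ∀ i → ¬ (i ≺ i)
    ≺-irrefl i (inj₁ lt) = ℕP.<-irrefl refl lt
    ≺-irrefl i (inj₂ (_ , lt)) = ℕP.<-irrefl refl lt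

    ≺-trans : ∀ {i j k} → i ≺ j → j ≺ k → i ≺ k
    ≺-trans (inj₁ p) (inj₁ q) = inj₁ (ℕP.<-trans p q)
    ≺-trans (inj₁ p) (inj₂ (q , _)) = inj₁ (subst (_ <_) q p)
    ≺-trans (inj₂ (p , _)) (inj₁ q) = inj₁ (subst (_< _) (sym p) q)
    ≺-trans (inj₂ (p , p')) (inj₂ (q , q')) = inj₂ (trans p q , ℕP.<-trans p' q')

    ≺-asym : ∀ {i j} → i ≺ j → ¬ (j ≺ i)
    ≺-asym p q = ≺-irrefl _ (≺-trans p q)

    ≺-tri : ∀ i j → i ≺ j ⊎ (i ≡ j ⊎ j ≺ i)
    ≺-tri i j with ℕP.<-cmp (colour i) (colour j)
    ... | tri< lt _ _ = inj₁ (inj₁ lt)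
    ... | tri> _ _ gt = inj₂ (inj₂ (inj₁ gt))
    ... | tri≈ _ eq _ with ℕP.<-cmp (toℕ i) (toℕ j)
    ...   | tri< lt _ _ = inj₁ (inj₂ (eq , lt))
    ...   | tri≈ _ e _ = inj₂ (inj₁ (FinP.toℕ-injective e))
    ...   | tri> _ _ gt = inj₂ (inj₂ (inj₂ (sym eq , gt)))

    #≺ : Fin n → ℕ
    #≺ i = count (_≺? i) (allFin n)

    rank≡#≺ : ∀ i → rank i ≡ #≺ i
    rank≡#≺ i = trans (ℕP.+-comm (#earlierOfColour (colour i) i) (#colourBelow (colour i)))
      (sym (trans (count-split (_≺? i) (λ j → colour j <? colour i) (allFin n))
        (cong₂ _+_ (count-cong _ _ (allFin n) (λ _ _ p → proj₂ p) (λ _ _ q → inj₁ q , q))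
          (trans (count-cong _ _ (allFin n)
              (λ j _ p → sameColour j (proj₁ p) (proj₂ p))
              (λ j _ q → inj₂ q , ℕP.<-irrefl (proj₁ q)))
            (sym (count-filter (λ j → colour j ≟ colour i) (λ j → toℕ j <? toℕ i) (allFin n)))))))
      where
      sameColour : ∀ j → j ≺ i → ¬ (colour j < colour i) → colour j ≡ colour i × toℕ j < toℕ i
      sameColour j (inj₁ lt) nlt = ⊥-elim (nlt lt)
      sameColour j (inj₂ q) _ = q

    #≺-mono : ∀ {i i'} → i' ≺ i → #≺ i' < #≺ i
    #≺-mono {i} {i'} lt = count-mono-< (_≺? i') (_≺? i) (allFin n)
      (λ j _ p → ≺-trans p lt) i' (MemP.∈-allFin i') lt (≺-irrefl i')

    Increasing : Set
    Increasing = ∀ (j j' : Fin n) → toℕ j' ≡ suc (toℕ j) → a j ≺ a j'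

    increasing-of-#≺≡τ : (∀ i → #≺ i ≡ toℕ (τ i)) → Increasing
    increasing-of-#≺≡τ #≺≡τ j j' j'≡1+j with ≺-tri (a j) (a j')
    ... | inj₁ l = l
    ... | inj₂ (inj₁ e) = ⊥-elim (ℕP.<-irrefl (cong toℕ (a-inj e)) j<j')
      where j<j' = subst (toℕ j <_) (sym j'≡1+j) (ℕP.n<1+n _)
    ... | inj₂ (inj₂ l) = ⊥-elim (ℕP.<-asym (subst (toℕ j <_) (sym j'≡1+j) (ℕP.n<1+n _))
          (subst₂ _<_ (position j') (position j) (#≺-mono l)))
      where
      position : ∀ j → #≺ (a j) ≡ toℕ j
      position j = trans (#≺≡τ (a j)) (cong toℕ (τ∘a j))

    increasing-far : Increasing → ∀ k (j j' : Fin n) → toℕ j' ≡ suc (k + toℕ j) → a j ≺ a j'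
    increasing-far inc zero j j' eq = inc j j' eq
    increasing-far inc (suc k) j j' eq =
      ≺-trans (increasing-far inc k j mid (FinP.toℕ-fromℕ< mid<n))
              (inc mid j' (trans eq (cong suc (sym (FinP.toℕ-fromℕ< mid<n)))))
      where
      mid<n : suc (k + toℕ j) < n
      mid<n = ℕP.<-trans (subst (suc (k + toℕ j) <_) (sym eq) (ℕP.n<1+n _)) (FinP.toℕ<n j')
      mid : Fin n
      mid = Fin.fromℕ< mid<n

    #≺≡τ-of-increasing : Increasing → ∀ i → #≺ i ≡ toℕ (τ i)
    #≺≡τ-of-increasing inc i =
      trans (count-cong _ (λ k → toℕ (τ k) <? toℕ (τ i)) (allFin n) (λ k _ → ≺⇒τ< k) (λ k _ → τ<⇒≺ k))
        (trans (count-allFin-bij (λ k → toℕ k <? toℕ (τ i)) τ a τ∘a a∘τ)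
          (count-<-allFin n (toℕ (τ i)) (ℕP.<⇒≤ (FinP.toℕ<n (τ i)))))
      where
      τ<⇒≺ : ∀ k → toℕ (τ k) < toℕ (τ i) → k ≺ i
      τ<⇒≺ k lt = subst₂ _≺_ (a∘τ k) (a∘τ i)
        (increasing-far inc (toℕ (τ i) ∸ suc (toℕ (τ k))) (τ k) (τ i)
          (sym (trans (sym (ℕP.+-suc _ (toℕ (τ k)))) (ℕP.m∸n+n≡m lt))))
      ≺⇒τ< : ∀ k → k ≺ i → toℕ (τ k) < toℕ (τ i)
      ≺⇒τ< k k≺i with ℕP.<-cmp (toℕ (τ k)) (toℕ (τ i))
      ... | tri< lt _ _ = lt
      ... | tri≈ _ e _ = ⊥-elim (≺-irrefl i (subst (_≺ i) k≡i k≺i))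
        where k≡i = trans (sym (a∘τ k)) (trans (cong a (FinP.toℕ-injective e)) (a∘τ i))
      ... | tri> _ _ gt = ⊥-elim (≺-asym k≺i (subst₂ _≺_ (a∘τ i) (a∘τ k)
            (increasing-far inc (toℕ (τ k) ∸ suc (toℕ (τ i))) (τ i) (τ k)
              (sym (trans (sym (ℕP.+-suc _ (toℕ (τ i)))) (ℕP.m∸n+n≡m gt))))))

    increasing-of-𝓡c≈Dσ : SameDiagram 𝓡c (Dπ σ) → Increasing
    increasing-of-𝓡c≈Dσ same =
      increasing-of-#≺≡τ (λ i → trans (sym (rank≡#≺ i)) (rank≡τ-of-𝓡c≈Dσ same i))

    𝓡c≈Dσ-of-increasing : Increasing → SameDiagram 𝓡c (Dπ σ)
    𝓡c≈Dσ-of-increasing inc = 𝓡c≈Dσ-of-rank≡τ (λ i → trans (rank≡#≺ i) (#≺≡τ-of-increasing inc i))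


module Staircase where

  -- Read along a word of distinct positions a₀ a₁ … a_m,
  -- a colour word y₀ y₁ … y_m over {0,…,ℓ-1} is a staircase when it climbs
  -- by exactly one at each descent a_{j+1} < a_j, by zero or one at each
  -- ascent, and ends at ℓ-1.  Starting from height x, such staircases are
  -- counted by C(F, ℓ-1-x-G), F and G being the numbers of ascents and descents:
  -- the G forced steps are fixed, and the remaining ℓ-1-x-G steps are placed on
  -- ascents.  Staircases starting at 0 are exactly the surjective colour words
  -- that are weakly increasing and strictly so at descents.

  open import Defs using (allVecs; descentsFrom)
  open Counting
  open Enumeration
  open Polynomials using (binomShift; binomShift-pascal; binomShift-pascal₀)
  open import Data.Nat.Combinatorics using (_C_)
  open import Function using (_∘_)
  open import Data.Nat using (ℕ; zero; suc; _+_; _∸_; _≤_; _<_; z≤n; s≤s; _<?_; _≟_)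
  import Data.Nat.Properties as ℕP
  open import Data.Nat.ListAction renaming (sum to sumℕ)
  import Data.Nat.ListAction.Properties as SumP
  open import Data.Fin using (Fin; toℕ)
  open import Data.Vec using (Vec; toList)
  open import Data.List as List using (List; []; _∷_; map; length; allFin; upTo; applyUpTo; zip)
  import Data.List.Properties as LP
  open import Data.List.Membership.Propositional using (_∈_)
  open import Data.List.Relation.Unary.Any using (here; there)
  open import Data.List.Relation.Unary.All using (All; _∷_)
  open import Data.Product using (_×_; _,_; proj₁; proj₂)
  open import Data.Sum using (_⊎_; inj₁; inj₂)
  open import Data.Unit using (⊤; tt)
  open import Data.Bool using (if_then_else_)
  open import Data.Empty using (⊥; ⊥-elim)
  open import Relation.Nullary using (Dec; yes; no; does; ¬_)
  open import Relation.Nullary.Decidable using (_×-dec_; _⊎-dec_)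
  open import Relation.Binary.PropositionalEquality using (_≡_; refl; sym; trans; cong; cong₂; subst; module ≡-Reasoning)

  ascentsFrom : ℕ → List ℕ → ℕ
  ascentsFrom a [] = 0
  ascentsFrom a (b ∷ r) = (if does (b <? a) then 0 else 1) + ascentsFrom b r

  ascents+descents : ∀ a r → ascentsFrom a r + descentsFrom a r ≡ length r
  ascents+descents a [] = refl
  ascents+descents a (b ∷ r) = split (b <? a)
    where
    split : (d : Dec (b < a)) →
      (if does d then 0 else 1) + ascentsFrom b r + ((if does d then 1 else 0) + descentsFrom b r) ≡ suc (length r)
    split (yes _) = trans (ℕP.+-suc (ascentsFrom b r) (descentsFrom b r)) (cong suc (ascents+descents b r))
    split (no _) = cong suc (ascents+descents b r)

  sum-upTo-point : ∀ L y (g : ℕ → ℕ) → sumℕ (map (λ k → ind (k ≟ y) (g k)) (upTo L)) ≡ ind (y <? L) (g y)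
  sum-upTo-point zero y g = refl
  sum-upTo-point (suc L) y g = begin
      sumℕ (map h (upTo (suc L)))
    ≡⟨ cong (λ l → sumℕ (map h l)) (sym (LP.upTo-∷ʳ L)) ⟩
      sumℕ (map h (upTo L List.∷ʳ L))
    ≡⟨ cong sumℕ (LP.map-++ h (upTo L) (L ∷ [])) ⟩
      sumℕ (map h (upTo L) List.++ (h L ∷ []))
    ≡⟨ SumP.sum-++ (map h (upTo L)) (h L ∷ []) ⟩
      sumℕ (map h (upTo L)) + (h L + 0)
    ≡⟨ cong₂ _+_ (sum-upTo-point L y g) (ℕP.+-identityʳ (h L)) ⟩
      ind (y <? L) (g y) + ind (L ≟ y) (g L)
    ≡⟨ extend (y <? L) (L ≟ y) (y <? suc L) ⟩
      ind (y <? suc L) (g y) ∎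
    where
    open ≡-Reasoning
    h : ℕ → ℕ
    h k = ind (k ≟ y) (g k)
    extend : (d₁ : Dec (y < L)) (d₂ : Dec (L ≡ y)) (d₃ : Dec (y < suc L)) →
      ind d₁ (g y) + ind d₂ (g L) ≡ ind d₃ (g y)
    extend (yes p) (yes refl) _ = ⊥-elim (ℕP.<-irrefl refl p)
    extend (yes p) (no _) (yes _) = ℕP.+-identityʳ _
    extend (yes p) (no _) (no q) = ⊥-elim (q (ℕP.m<n⇒m<1+n p))
    extend (no _) (yes refl) (yes _) = refl
    extend (no _) (yes refl) (no q) = ⊥-elim (q ℕP.≤-refl)
    extend (no p) (no r) (yes q) = ⊥-elim (r (sym (ℕP.≤-antisym (ℕP.≤-pred q) (ℕP.≮⇒≥ p))))
    extend (no _) (no _) (no _) = refl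

  ∸-suc : ∀ {x ℓ} → x < ℓ → ℓ ∸ x ≡ suc (ℓ ∸ suc x)
  ∸-suc {zero} {suc ℓ} _ = refl
  ∸-suc {suc x} {suc ℓ} (s≤s lt) = ∸-suc lt

  increasing-run : ∀ m x (g : ℕ → ℕ) → x ≤ g 0 → (∀ k → g k ≤ g (suc k)) →
    descentsFrom x (applyUpTo g m) ≡ 0 × ascentsFrom x (applyUpTo g m) ≡ m
  increasing-run zero x g _ _ = refl , refl
  increasing-run (suc m) x g x≤g0 inc = step (g 0 <? x)
    where
    rest : descentsFrom (g 0) (applyUpTo (g ∘ suc) m) ≡ 0 × ascentsFrom (g 0) (applyUpTo (g ∘ suc) m) ≡ m
    rest = increasing-run m (g 0) (g ∘ suc) (inc 0) (inc ∘ suc)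
    step : (d : Dec (g 0 < x)) →
      ((if does d then 1 else 0) + descentsFrom (g 0) (applyUpTo (g ∘ suc) m) ≡ 0) ×
      ((if does d then 0 else 1) + ascentsFrom (g 0) (applyUpTo (g ∘ suc) m) ≡ suc m)
    step (yes g0<x) = ⊥-elim (ℕP.<-irrefl refl (ℕP.<-≤-trans g0<x x≤g0))
    step (no _) = proj₁ rest , cong suc (proj₂ rest)

  module Staircases (ℓ : ℕ) where

    -- the admissible steps x → y after a descent (d positive) or an ascent
    Step : {P : Set} → Dec P → ℕ → ℕ → Set
    Step (yes _) x y = y ≡ suc x
    Step (no _) x y = y ≡ x ⊎ y ≡ suc x

    step? : {P : Set} (d : Dec P) (x y : ℕ) → Dec (Step d x y)
    step? (yes _) x y = y ≟ suc x
    step? (no _) x y = (y ≟ x) ⊎-dec (y ≟ suc x)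

    -- Staircase pa x ps: from position pa at height x, the list ps of
    -- (position, height) pairs is a staircase ending at height ℓ-1.
    Staircase : ℕ → ℕ → List (ℕ × ℕ) → Set
    Staircase pa x [] = suc x ≡ ℓ
    Staircase pa x ((a , y) ∷ ps) = Step (a <? pa) x y × Staircase a y ps

    staircase? : ∀ pa x ps → Dec (Staircase pa x ps)
    staircase? pa x [] = suc x ≟ ℓ
    staircase? pa x ((a , y) ∷ ps) = step? (a <? pa) x y ×-dec staircase? a y ps

    heights : ∀ {k} → Vec (Fin ℓ) k → List ℕ
    heights v = map toℕ (toList v)

    #staircases : ℕ → ℕ → List ℕ → ℕ
    #staircases pa x as = count (λ v → staircase? pa x (zip as (heights v))) (allVecs ℓ (length as))

    module _ (x : ℕ) (x<ℓ : x < ℓ) (T : ℕ → ℕ) where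

      sum-after-descent : ∀ {P} (d : P) F G → (∀ y → y < ℓ → T y ≡ binomShift F G (ℓ ∸ suc y)) →
        sumℕ (map (λ y → ind (step? (yes d) x y) (T y)) (upTo ℓ)) ≡ binomShift F (suc G) (ℓ ∸ suc x)
      sum-after-descent d F G T≡ = trans (sum-upTo-point ℓ (suc x) T) (last (suc x <? ℓ))
        where
        last : (d : Dec (suc x < ℓ)) → ind d (T (suc x)) ≡ binomShift F (suc G) (ℓ ∸ suc x)
        last (yes lt) = trans (T≡ (suc x) lt) (cong (binomShift F (suc G)) (sym (∸-suc lt)))
        last (no nlt) = sym (cong (binomShift F (suc G)) (ℕP.m≤n⇒m∸n≡0 (ℕP.≮⇒≥ nlt)))

      -- after an ascent y = x and y = x + 1 are possible: Pascal's rule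
      sum-after-ascent : ∀ {P} (d : ¬ P) F G → (∀ y → y < ℓ → T y ≡ binomShift F G (ℓ ∸ suc y)) →
        sumℕ (map (λ y → ind (step? (no d) x y) (T y)) (upTo ℓ)) ≡ binomShift (suc F) G (ℓ ∸ suc x)
      sum-after-ascent d F G T≡ = begin
          sumℕ (map (λ y → ind ((y ≟ x) ⊎-dec (y ≟ suc x)) (T y)) (upTo ℓ))
        ≡⟨ sum-cong-∈ (upTo ℓ) (λ y _ → split y) ⟩
          sumℕ (map (λ y → ind (y ≟ x) (T y) + ind (y ≟ suc x) (T y)) (upTo ℓ))
        ≡⟨ sum-+ (λ y → ind (y ≟ x) (T y)) (λ y → ind (y ≟ suc x) (T y)) (upTo ℓ) ⟩
          sumℕ (map (λ y → ind (y ≟ x) (T y)) (upTo ℓ)) + sumℕ (map (λ y → ind (y ≟ suc x) (T y)) (upTo ℓ))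
        ≡⟨ cong₂ _+_ (sum-upTo-point ℓ x T) (sum-upTo-point ℓ (suc x) T) ⟩
          ind (x <? ℓ) (T x) + ind (suc x <? ℓ) (T (suc x))
        ≡⟨ pascal (x <? ℓ) (suc x <? ℓ) ⟩
          binomShift (suc F) G (ℓ ∸ suc x) ∎
        where
        open ≡-Reasoning
        split : ∀ y → ind ((y ≟ x) ⊎-dec (y ≟ suc x)) (T y) ≡ ind (y ≟ x) (T y) + ind (y ≟ suc x) (T y)
        split y with y ≟ x | y ≟ suc x
        ... | yes refl | yes e = ⊥-elim (ℕP.<-irrefl e (ℕP.n<1+n y))
        ... | yes _ | no _ = sym (ℕP.+-identityʳ _)
        ... | no _ | yes _ = refl
        ... | no _ | no _ = refl
        pascal : (d₁ : Dec (x < ℓ)) (d₂ : Dec (suc x < ℓ)) →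
          ind d₁ (T x) + ind d₂ (T (suc x)) ≡ binomShift (suc F) G (ℓ ∸ suc x)
        pascal (no ¬p) _ = ⊥-elim (¬p x<ℓ)
        pascal (yes _) (yes lt) rewrite T≡ x x<ℓ | T≡ (suc x) lt | ∸-suc lt =
          sym (binomShift-pascal F G (ℓ ∸ suc (suc x)))
        pascal (yes _) (no nlt) rewrite T≡ x x<ℓ | ℕP.m≤n⇒m∸n≡0 (ℕP.≮⇒≥ nlt) =
          trans (ℕP.+-identityʳ _) (sym (binomShift-pascal₀ F G))

    #staircases-formula : ∀ pa x as → x < ℓ →
      #staircases pa x as ≡ binomShift (ascentsFrom pa as) (descentsFrom pa as) (ℓ ∸ suc x)
    #staircases-formula pa x [] x<ℓ = finished (suc x ≟ ℓ)
      where
      finished : (d : Dec (suc x ≡ ℓ)) → count (λ _ → d) (allVecs ℓ 0) ≡ 0 C (ℓ ∸ suc x)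
      finished (yes refl) = cong (0 C_) (sym (ℕP.n∸n≡0 (suc x)))
      finished (no ≢) = cong (0 C_) (sym (∸-suc (ℕP.≤∧≢⇒< x<ℓ ≢)))
    #staircases-formula pa x (a ∷ as) x<ℓ = begin
        count (λ v → staircase? pa x (zip (a ∷ as) (heights v))) (allVecs ℓ (suc (length as)))
      ≡⟨ count-allVecs-suc ℓ (length as) (λ v → staircase? pa x (zip (a ∷ as) (heights v))) ⟩
        sumℕ (map (λ i → count (λ v → first? (toℕ i) ×-dec rest? (toℕ i) v) words) (allFin ℓ))
      ≡⟨ sum-cong-∈ (allFin ℓ) (λ i _ → count-and-const (first? (toℕ i)) (rest? (toℕ i)) words) ⟩
        sumℕ (map (T′ ∘ toℕ) (allFin ℓ))
      ≡⟨ cong sumℕ (trans (LP.map-∘ (allFin ℓ)) (cong (map T′) (map-toℕ-allFin ℓ))) ⟩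
        sumℕ (map T′ (upTo ℓ))
      ≡⟨ first-step (a <? pa) ⟩
        binomShift (ascentsFrom pa (a ∷ as)) (descentsFrom pa (a ∷ as)) (ℓ ∸ suc x) ∎
      where
      open ≡-Reasoning
      words : List (Vec (Fin ℓ) (length as))
      words = allVecs ℓ (length as)
      first? : ∀ y → Dec (Step (a <? pa) x y)
      first? = step? (a <? pa) x
      rest? : ∀ y (v : Vec (Fin ℓ) (length as)) → Dec (Staircase a y (zip as (heights v)))
      rest? y v = staircase? a y (zip as (heights v))
      T′ : ℕ → ℕ
      T′ y = ind (first? y) (#staircases a y as)
      IH : ∀ y → y < ℓ → #staircases a y as ≡ binomShift (ascentsFrom a as) (descentsFrom a as) (ℓ ∸ suc y)
      IH y = #staircases-formula a y as
      first-step : (d : Dec (a < pa)) → sumℕ (map (λ y → ind (step? d x y) (#staircases a y as)) (upTo ℓ)) ≡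
        binomShift ((if does d then 0 else 1) + ascentsFrom a as) ((if does d then 1 else 0) + descentsFrom a as)
                   (ℓ ∸ suc x)
      first-step (yes dsc) = sum-after-descent x x<ℓ _ dsc (ascentsFrom a as) (descentsFrom a as) IH
      first-step (no asc) = sum-after-ascent x x<ℓ _ asc (ascentsFrom a as) (descentsFrom a as) IH

  -- Staircases are the compatible chains that cover all heights.

  Compatible : ℕ × ℕ → ℕ × ℕ → Set
  Compatible (pa , x) (a , y) = x ≤ y × (a < pa → x < y)

  CompatibleChain : List (ℕ × ℕ) → Set
  CompatibleChain (p ∷ q ∷ ps) = Compatible p q × CompatibleChain (q ∷ ps)
  CompatibleChain _ = ⊤

  chain-lower-bound : ∀ pa x ps → CompatibleChain ((pa , x) ∷ ps) → ∀ t → t ∈ map proj₂ ps → x ≤ t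
  chain-lower-bound pa x ((a , y) ∷ ps) (xy , _) t (here refl) = proj₁ xy
  chain-lower-bound pa x ((a , y) ∷ ps) (xy , rest) t (there t∈) =
    ℕP.≤-trans (proj₁ xy) (chain-lower-bound a y ps rest t t∈)

  module Characterisation (ℓ : ℕ) where
    open Staircases ℓ

    Covers : ℕ → List ℕ → Set
    Covers x us = ∀ t → x ≤ t → t < ℓ → t ∈ us

    staircase-of-chain : ∀ pa x ps → x < ℓ → All (λ p → proj₂ p < ℓ) ps →
      Covers x (x ∷ map proj₂ ps) → CompatibleChain ((pa , x) ∷ ps) → Staircase pa x ps
    staircase-of-chain pa x [] x<ℓ _ cov _ = last ℓ x<ℓ (cov (ℓ ∸ 1))
      where
      last : ∀ L → x < L → (x ≤ L ∸ 1 → L ∸ 1 < L → L ∸ 1 ∈ x ∷ []) → suc x ≡ L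
      last (suc L) (s≤s x≤L) top with top x≤L ℕP.≤-refl
      ... | here eq = cong suc (sym eq)
    staircase-of-chain pa x ((a , y) ∷ ps) x<ℓ (y<ℓ ∷ bounds) cov (xy , rest) =
      step (a <? pa) (proj₂ xy) , staircase-of-chain a y ps y<ℓ bounds covers-y rest
      where
      -- no height strictly between x and y is skipped
      y≤1+x : y ≤ suc x
      y≤1+x = ℕP.≮⇒≥ no-gap
        where
        no-gap : suc x < y → ⊥
        no-gap lt with cov (suc x) (ℕP.n≤1+n x) (ℕP.<-trans lt y<ℓ)
        ... | here eq = ℕP.<-irrefl (sym eq) (ℕP.n<1+n x)
        ... | there (here eq) = ℕP.<-irrefl eq lt
        ... | there (there t∈) = ℕP.<-irrefl refl (ℕP.<-≤-trans lt (chain-lower-bound a y ps rest (suc x) t∈))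
      step : (d : Dec (a < pa)) → (a < pa → x < y) → Step d x y
      step (yes lt) strict = ℕP.≤-antisym y≤1+x (strict lt)
      step (no _) _ with ℕP.m≤n⇒m<n∨m≡n (proj₁ xy)
      ... | inj₂ eq = inj₁ (sym eq)
      ... | inj₁ lt = inj₂ (ℕP.≤-antisym y≤1+x lt)
      covers-y : Covers y (y ∷ map proj₂ ps)
      covers-y t y≤t t<ℓ with cov t (ℕP.≤-trans (proj₁ xy) y≤t) t<ℓ
      ... | here refl = here (sym (ℕP.≤-antisym y≤t (proj₁ xy)))
      ... | there t∈ = t∈

    chain-of-staircase : ∀ pa x ps → Staircase pa x ps →
      Covers x (x ∷ map proj₂ ps) × CompatibleChain ((pa , x) ∷ ps)
    chain-of-staircase pa x [] 1+x≡ℓ =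
      (λ t x≤t t<ℓ → here (ℕP.≤-antisym (ℕP.≤-pred (subst (t <_) (sym 1+x≡ℓ) t<ℓ)) x≤t)) , tt
    chain-of-staircase pa x ((a , y) ∷ ps) (st , rest) =
      covers , (compatible (a <? pa) st , proj₂ (chain-of-staircase a y ps rest))
      where
      compatible : (d : Dec (a < pa)) → Step d x y → Compatible (pa , x) (a , y)
      compatible (yes _) refl = ℕP.n≤1+n x , λ _ → ℕP.n<1+n x
      compatible (no ¬lt) (inj₁ refl) = ℕP.≤-refl , λ lt → ⊥-elim (¬lt lt)
      compatible (no ¬lt) (inj₂ refl) = ℕP.n≤1+n x , λ _ → ℕP.n<1+n x
      y≤1+x : (d : Dec (a < pa)) → Step d x y → y ≤ suc x
      y≤1+x (yes _) refl = ℕP.≤-refl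
      y≤1+x (no _) (inj₁ refl) = ℕP.n≤1+n x
      y≤1+x (no _) (inj₂ refl) = ℕP.≤-refl
      covers : Covers x (x ∷ y ∷ map proj₂ ps)
      covers t x≤t t<ℓ with ℕP.m≤n⇒m<n∨m≡n x≤t
      ... | inj₂ refl = here refl
      ... | inj₁ x<t = there (proj₁ (chain-of-staircase a y ps rest) t (ℕP.≤-trans (y≤1+x (a <? pa) st) x<t) t<ℓ)

    staircase-of-chain₀ : ∀ pa x ps → x < ℓ → All (λ p → proj₂ p < ℓ) ps →
      Covers 0 (x ∷ map proj₂ ps) → CompatibleChain ((pa , x) ∷ ps) → (x ≡ 0) × Staircase pa x ps
    staircase-of-chain₀ pa x ps x<ℓ bounds cov chain =
      x≡0 , staircase-of-chain pa x ps x<ℓ bounds (subst (λ z → Covers z (x ∷ map proj₂ ps)) (sym x≡0) cov) chain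
      where
      x≡0 : x ≡ 0
      x≡0 with cov 0 z≤n (ℕP.≤-trans (s≤s z≤n) x<ℓ)
      ... | here eq = sym eq
      ... | there t∈ = ℕP.n≤0⇒n≡0 (chain-lower-bound pa x ps chain 0 t∈)

    chain-of-staircase₀ : ∀ pa x ps → (x ≡ 0) × Staircase pa x ps →
      Covers 0 (x ∷ map proj₂ ps) × CompatibleChain ((pa , x) ∷ ps)
    chain-of-staircase₀ pa .0 ps (refl , st) = chain-of-staircase pa 0 ps st


module ColouringCount where

  -- By the rank criterion a colouring c is counted iff it is surjective and
  -- a(j) ≺ a(j+1) for all j; in terms of the colour word c(a(0)) … c(a(n-1))
  -- this says exactly that it is a staircase starting at 0.  Reindexing the
  -- colourings by c ↦ c ∘ a turns the count into a count of staircases.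

  open import Defs
  open Counting
  open Enumeration
  open ColouredDiagram using (𝓡ˡ)
  open RankCriterion
  open Staircase
  open Polynomials using (binomShift)
  open import Data.Nat using (ℕ; zero; suc; _∸_; _<_; z≤n; _<?_; _≟_)
  import Data.Nat.Properties as ℕP
  open import Data.Nat.ListAction renaming (sum to sumℕ)
  open import Data.Fin as Fin using (Fin; toℕ)
  import Data.Fin.Properties as FinP
  open import Data.Vec as Vec using (Vec; _∷_; toList)
  import Data.Vec.Properties as VecP
  open import Data.List as List using (List; _∷_; map; length; allFin; zip)
  import Data.List.Properties as LP
  open import Data.List.Membership.Propositional using (_∈_)
  import Data.List.Membership.Propositional.Properties as MemP
  import Data.List.Relation.Unary.All as All
  import Data.List.Membership.DecPropositional as DecMem
  open import Data.List.Relation.Unary.All using (All)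
  open import Data.Product using (_×_; _,_; proj₁; proj₂)
  open import Data.Sum using (inj₁; inj₂)
  open import Data.Unit using (tt)
  open import Data.Empty using (⊥-elim)
  open import Function using (_∘_)
  open import Relation.Nullary using (Dec; yes; no)
  open import Relation.Nullary.Decidable using (_×-dec_)
  open import Relation.Unary using (Decidable)
  open import Relation.Binary.Definitions using (tri<; tri≈; tri>)
  open import Relation.Binary.PropositionalEquality using (_≡_; _≢_; refl; sym; trans; cong; subst; module ≡-Reasoning)

  AdjacentCompatible : (m : ℕ) → (Fin (suc m) → ℕ × ℕ) → Set
  AdjacentCompatible m g = ∀ (j j' : Fin (suc m)) → toℕ j' ≡ suc (toℕ j) → Compatible (g j) (g j')

  chainOf : (m : ℕ) → (Fin (suc m) → ℕ × ℕ) → List (ℕ × ℕ)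
  chainOf m g = g Fin.zero ∷ map (g ∘ Fin.suc) (allFin m)

  chain-of-adjacent : ∀ m g → AdjacentCompatible m g → CompatibleChain (chainOf m g)
  chain-of-adjacent zero g adj = tt
  chain-of-adjacent (suc k) g adj = subst (λ l → CompatibleChain (g Fin.zero ∷ l)) (sym (map-allFin-suc (g ∘ Fin.suc)))
    (adj Fin.zero (Fin.suc Fin.zero) refl ,
     chain-of-adjacent k (g ∘ Fin.suc) (λ j j' e → adj (Fin.suc j) (Fin.suc j') (cong suc e)))

  adjacent-of-chain : ∀ m g → CompatibleChain (chainOf m g) → AdjacentCompatible m g
  adjacent-of-chain zero g chain Fin.zero Fin.zero ()
  adjacent-of-chain (suc k) g chain = adjacent
    where
    head,tail : Compatible (g Fin.zero) (g (Fin.suc Fin.zero)) × CompatibleChain (chainOf k (g ∘ Fin.suc))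
    head,tail = subst (λ l → CompatibleChain (g Fin.zero ∷ l)) (map-allFin-suc (g ∘ Fin.suc)) chain
    adjacent : AdjacentCompatible (suc k) g
    adjacent Fin.zero Fin.zero ()
    adjacent Fin.zero (Fin.suc j') e with FinP.toℕ-injective {i = j'} {j = Fin.zero} (ℕP.suc-injective e)
    ... | refl = proj₁ head,tail
    adjacent (Fin.suc j) (Fin.suc j') e = adjacent-of-chain k (g ∘ Fin.suc) (proj₂ head,tail) j j' (ℕP.suc-injective e)

  length-Dπ : ∀ {n} (ψ : Fin n → Fin n) → length (Dπ ψ) ≡ n
  length-Dπ {n} ψ = trans (LP.length-map _ (allFin n)) (LP.length-tabulate (λ x → x))

  module Count (m : ℕ) (φ : Factorisation (suc m)) where
    open Factorisation φ

    a₀ : ℕ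
    a₀ = toℕ (a Fin.zero)

    as : List ℕ
    as = map (toℕ ∘ a ∘ Fin.suc) (allFin m)

    module WithColours (ℓ : ℕ) where
      open Staircases ℓ
      open Characterisation ℓ

      Counted : Vec (Fin ℓ) (suc m) → Set
      Counted c = Surjective c × SameDiagram (𝓡ˡ (Dπ π) (toList c)) (Dπ σ)

      counted? : ∀ c → Dec (Counted c)
      counted? c = surjective? c ×-dec sameDiagram? (𝓡ˡ (Dπ π) (toList c)) (Dπ σ)

      module _ (c : Vec (Fin ℓ) (suc m)) where
        open Criterion φ ℓ c

        word : Fin (suc m) → ℕ × ℕ
        word j = (toℕ (a j) , colour (a j))

        compatible-of-≺ : ∀ j j' → a j ≺ a j' → Compatible (word j) (word j')
        compatible-of-≺ j j' (inj₁ lt) = ℕP.<⇒≤ lt , λ _ → lt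
        compatible-of-≺ j j' (inj₂ (eq , lt)) = ℕP.≤-reflexive eq , λ lt' → ⊥-elim (ℕP.<-asym lt lt')

        ≺-of-compatible : ∀ j j' → j ≢ j' → Compatible (word j) (word j') → a j ≺ a j'
        ≺-of-compatible j j' j≢j' (le , strict) with ℕP.m≤n⇒m<n∨m≡n le
        ... | inj₁ lt = inj₁ lt
        ... | inj₂ eq with ℕP.<-cmp (toℕ (a j)) (toℕ (a j'))
        ...   | tri< lt _ _ = inj₂ (eq , lt)
        ...   | tri≈ _ e _ = ⊥-elim (j≢j' (a-inj (FinP.toℕ-injective e)))
        ...   | tri> _ _ gt = ⊥-elim (ℕP.<-irrefl eq (strict gt))

        chain-of-increasing : Increasing → CompatibleChain (chainOf m word)
        chain-of-increasing inc = chain-of-adjacent m word (λ j j' e → compatible-of-≺ j j' (inc j j' e))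

        increasing-of-chain : CompatibleChain (chainOf m word) → Increasing
        increasing-of-chain chain j j' e = ≺-of-compatible j j' j≢j' (adjacent-of-chain m word chain j j' e)
          where
          j≢j' : j ≢ j'
          j≢j' refl = ℕP.<-irrefl e (ℕP.n<1+n (toℕ j))

        tail-pairs : List (ℕ × ℕ)
        tail-pairs = map (word ∘ Fin.suc) (allFin m)

        colours-along-a : map (colour ∘ a) (allFin (suc m)) ≡ colour (a Fin.zero) ∷ map proj₂ tail-pairs
        colours-along-a = trans (map-allFin-suc (colour ∘ a)) (cong (colour (a Fin.zero) ∷_) (LP.map-∘ (allFin m)))

        tail-bounded : All (λ p → proj₂ p < ℓ) tail-pairs
        tail-bounded = All.tabulate bounded
          where
          bounded : ∀ {x} → x ∈ tail-pairs → proj₂ x < ℓ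
          bounded x∈ with MemP.∈-map⁻ (word ∘ Fin.suc) x∈
          ... | j , _ , refl = FinP.toℕ<n (col (a (Fin.suc j)))

        ∈colours : ∀ i → col i ∈ toList c
        ∈colours i = subst (col i ∈_) (sym (toList-lookup c)) (MemP.∈-map⁺ col (MemP.∈-allFin i))

        covers-of-surjective : Surjective c → Covers 0 (map (colour ∘ a) (allFin (suc m)))
        covers-of-surjective surj t _ t<ℓ with MemP.∈-map⁻ col (subst (Fin.fromℕ< t<ℓ ∈_) (toList-lookup c)
                                                   (All.lookup surj (MemP.∈-allFin (Fin.fromℕ< t<ℓ))))
        ... | i , _ , eq = subst (_∈ map (colour ∘ a) (allFin (suc m)))
            (trans (cong colour (a∘τ i)) (trans (cong toℕ (sym eq)) (FinP.toℕ-fromℕ< t<ℓ)))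
            (MemP.∈-map⁺ (colour ∘ a) (MemP.∈-allFin (τ i)))

        surjective-of-covers : Covers 0 (map (colour ∘ a) (allFin (suc m))) → Surjective c
        surjective-of-covers cov = All.tabulate (λ {t} _ → hit t)
          where
          hit : ∀ t → t ∈ toList c
          hit t with MemP.∈-map⁻ (colour ∘ a) (cov (toℕ t) z≤n (FinP.toℕ<n t))
          ... | j , _ , eq = subst (_∈ toList c) (sym (FinP.toℕ-injective eq)) (∈colours (a j))

        StaircaseAlong : Set
        StaircaseAlong = (colour (a Fin.zero) ≡ 0) × Staircase a₀ (colour (a Fin.zero)) tail-pairs

        staircase-of-counted : Counted c → StaircaseAlong
        staircase-of-counted (surj , same) =
          staircase-of-chain₀ a₀ (colour (a Fin.zero)) tail-pairs (FinP.toℕ<n (col (a Fin.zero))) tail-bounded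
            (subst (Covers 0) colours-along-a (covers-of-surjective surj))
            (chain-of-increasing (increasing-of-𝓡c≈Dσ same))

        counted-of-staircase : StaircaseAlong → Counted c
        counted-of-staircase st with chain-of-staircase₀ a₀ (colour (a Fin.zero)) tail-pairs st
        ... | cov , chain = surjective-of-covers (subst (Covers 0) (sym colours-along-a) cov) ,
                            𝓡c≈Dσ-of-increasing (increasing-of-chain chain)

      along-a : Vec (Fin ℓ) (suc m) → Vec (Fin ℓ) (suc m)
      along-a c = Vec.tabulate (Vec.lookup c ∘ a)

      along-τ : Vec (Fin ℓ) (suc m) → Vec (Fin ℓ) (suc m)
      along-τ d = Vec.tabulate (Vec.lookup d ∘ τ)

      along-a∘along-τ : ∀ d → along-a (along-τ d) ≡ d
      along-a∘along-τ d = trans (VecP.tabulate-cong (λ j → trans (VecP.lookup∘tabulate (Vec.lookup d ∘ τ) (a j))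
        (cong (Vec.lookup d) (τ∘a j)))) (VecP.tabulate∘lookup d)

      along-τ∘along-a : ∀ c → along-τ (along-a c) ≡ c
      along-τ∘along-a c = trans (VecP.tabulate-cong (λ i → trans (VecP.lookup∘tabulate (Vec.lookup c ∘ a) (τ i))
        (cong (Vec.lookup c) (a∘τ i)))) (VecP.tabulate∘lookup c)

      StartsStaircase : Vec (Fin ℓ) (suc m) → Set
      StartsStaircase (i ∷ v) = (toℕ i ≡ 0) × Staircase a₀ (toℕ i) (zip as (heights v))

      startsStaircase? : Decidable StartsStaircase
      startsStaircase? (i ∷ v) = (toℕ i ≟ 0) ×-dec staircase? a₀ (toℕ i) (zip as (heights v))

      zip-along-a : ∀ c → zip as (heights (Vec.tabulate (Vec.lookup c ∘ a ∘ Fin.suc))) ≡ tail-pairs c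
      zip-along-a c =
        trans (cong (zip as) heights-tail) (zip-map (toℕ ∘ a ∘ Fin.suc) (toℕ ∘ Vec.lookup c ∘ a ∘ Fin.suc) (allFin m))
        where
        v : Vec (Fin ℓ) m
        v = Vec.tabulate (Vec.lookup c ∘ a ∘ Fin.suc)
        heights-tail : heights v ≡ map (toℕ ∘ Vec.lookup c ∘ a ∘ Fin.suc) (allFin m)
        heights-tail = trans (cong (map toℕ) (toList-lookup v))
          (trans (sym (LP.map-∘ (allFin m)))
                 (LP.map-cong (cong toℕ ∘ VecP.lookup∘tabulate (Vec.lookup c ∘ a ∘ Fin.suc)) (allFin m)))

      #counted≡#staircases : count counted? (allVecs ℓ (suc m)) ≡ count startsStaircase? (allVecs ℓ (suc m))
      #counted≡#staircases = trans (count-cong counted? (startsStaircase? ∘ along-a) (allVecs ℓ (suc m))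
          (λ c _ p → let (z , st) = staircase-of-counted c p in z , subst (Staircase a₀ _) (sym (zip-along-a c)) st)
          (λ c _ (z , st) → counted-of-staircase c (z , subst (Staircase a₀ _) (zip-along-a c) st)))
        (count-allVecs-bij startsStaircase? along-a along-τ along-a∘along-τ along-τ∘along-a)

      #staircases-from-0 : 0 < ℓ → count startsStaircase? (allVecs ℓ (suc m)) ≡
        binomShift (ascentsFrom a₀ as) (descentsFrom a₀ as) (ℓ ∸ 1)
      #staircases-from-0 0<ℓ = begin
          count startsStaircase? (allVecs ℓ (suc m))
        ≡⟨ count-allVecs-suc ℓ m startsStaircase? ⟩
          sumℕ (map (λ i → count (startsStaircase? ∘ (i ∷_)) (allVecs ℓ m)) (allFin ℓ))
        ≡⟨ sum-cong-∈ (allFin ℓ) (λ i _ → first-height i) ⟩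
          sumℕ (map (λ i → ind (toℕ i ≟ 0) (#staircases a₀ (toℕ i) as)) (allFin ℓ))
        ≡⟨ cong sumℕ (trans (LP.map-∘ (allFin ℓ))
                            (cong (map (λ y → ind (y ≟ 0) (#staircases a₀ y as))) (map-toℕ-allFin ℓ))) ⟩
          sumℕ (map (λ y → ind (y ≟ 0) (#staircases a₀ y as)) (List.upTo ℓ))
        ≡⟨ sum-upTo-point ℓ 0 (λ y → #staircases a₀ y as) ⟩
          ind (0 <? ℓ) (#staircases a₀ 0 as)
        ≡⟨ positive (0 <? ℓ) ⟩
          #staircases a₀ 0 as
        ≡⟨ #staircases-formula a₀ 0 as 0<ℓ ⟩
          binomShift (ascentsFrom a₀ as) (descentsFrom a₀ as) (ℓ ∸ 1) ∎
        where
        open ≡-Reasoning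
        length-as : length as ≡ m
        length-as = trans (LP.length-map _ (allFin m)) (LP.length-tabulate (λ x → x))
        first-height : ∀ i → count (startsStaircase? ∘ (i ∷_)) (allVecs ℓ m) ≡ ind (toℕ i ≟ 0) (#staircases a₀ (toℕ i) as)
        first-height i =
          trans (count-and-const (toℕ i ≟ 0) (λ v → staircase? a₀ (toℕ i) (zip as (heights v))) (allVecs ℓ m))
            (cong (ind (toℕ i ≟ 0))
              (sym (count-allVecs-length (λ cs → staircase? a₀ (toℕ i) (zip as (map toℕ cs))) length-as)))
        positive : (d : Dec (0 < ℓ)) → ind d (#staircases a₀ 0 as) ≡ #staircases a₀ 0 as
        positive (yes _) = refl
        positive (no ¬p) = ⊥-elim (¬p 0<ℓ)

      f-formula : 0 < ℓ → f (Dπ π) (Dπ σ) ℓ ≡ binomShift (ascentsFrom a₀ as) (descentsFrom a₀ as) (ℓ ∸ 1)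
      f-formula 0<ℓ = begin
          f (Dπ π) (Dπ σ) ℓ
        ≡⟨ count-allVecs-length (λ cs → surjectiveˡ? cs ×-dec sameDiagram? (𝓡ˡ (Dπ π) cs) (Dπ σ))
                                (length-Dπ π) ⟩
          count counted? (allVecs ℓ (suc m))
        ≡⟨ #counted≡#staircases ⟩
          count startsStaircase? (allVecs ℓ (suc m))
        ≡⟨ #staircases-from-0 0<ℓ ⟩
          binomShift (ascentsFrom a₀ as) (descentsFrom a₀ as) (ℓ ∸ 1) ∎
        where
        open ≡-Reasoning
        surjectiveˡ? : (cs : List (Fin ℓ)) → Dec (All (λ t → t ∈ cs) (allFin ℓ))
        surjectiveˡ? cs = All.all? (λ t → DecMem._∈?_ FinP._≟_ t cs) (allFin ℓ)


module AlternatingSum where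

  -- The G vanishing terms shift the sum to (-1)^G Σ_k (-1)^k C(F,k)/(G+k+1), a
  -- Beta integral ∫₀¹ t^G (1-t)^F dt = F! G!/(F+G+1)!, proved by induction on F
  -- with Pascal's rule.  The computation is done in the unnormalised rationals
  -- ℚᵘ (whose equality ≃ is a congruence for the ring solver) and transferred
  -- to ℚ at the end.

  open import Defs using (neg1^; sumℚ; recipℕ)
  open Polynomials using (binomShift)
  open import Data.Nat as ℕ using (ℕ; zero; suc; _≤_; _<_; s≤s; _!)
  import Data.Nat.Properties as ℕP
  open import Data.Nat.Combinatorics using (_C_; nCk+nC[k+1]≡[n+1]C[k+1]; k![n∸k]!∣n!)
  import Data.Nat.Combinatorics.Specification as CSpec
  open import Data.Nat.DivMod using (m/n*n≡m)
  open import Data.Integer as ℤ using (ℤ; +_)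
  import Data.Integer.Properties as ℤP
  open import Data.Integer.Solver renaming (module +-*-Solver to ℤS)
  open import Data.Rational as Q using (ℚ; toℚᵘ)
  import Data.Rational.Properties as QP
  open import Data.Rational.Unnormalised as U using (ℚᵘ; mkℚᵘ; _≃_; *≡*; 0ℚᵘ; 1ℚᵘ; _+_; _*_; -_; _-_)
  import Data.Rational.Unnormalised.Properties as UP
  open import Data.Rational.Unnormalised.Solver using (module +-*-Solver)
  open import Data.List as List using (map; upTo; applyUpTo)
  import Data.List.Properties as LP
  open import Relation.Binary.PropositionalEquality using (_≡_; refl; sym; trans; cong; cong₂; subst; module ≡-Reasoning)
  open import Function using (_∘_)

  open UP using (≃-refl; ≃-sym; ≃-trans; ≃-reflexive)

  -- ι and ιn embed ℤ and ℕ; ρ d is 1/d (and 0 for d = 0, as recipℕ).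
  ι : ℤ → ℚᵘ
  ι z = mkℚᵘ z 0

  ρ : ℕ → ℚᵘ
  ρ zero = 0ℚᵘ
  ρ (suc d) = mkℚᵘ (+ 1) d

  ιn : ℕ → ℚᵘ
  ιn x = ι (+ x)

  ι-+ : ∀ x y → ι (x ℤ.+ y) ≃ ι x + ι y
  ι-+ x y = *≡* (solve 2 (λ x y → (x :+ y) :* con (+ 1) := (x :* con (+ 1) :+ y :* con (+ 1)) :* con (+ 1))
                         refl x y)
    where open ℤS

  ιn-* : ∀ a b → ιn (a ℕ.* b) ≃ ιn a * ιn b
  ιn-* a b = ≃-reflexive (cong ι (ℤP.pos-* a b))

  ιn-+ : ∀ a b → ιn (a ℕ.+ b) ≃ ιn a + ιn b
  ιn-+ a b = ι-+ (+ a) (+ b)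

  ρ-* : ∀ a b → ρ (a ℕ.* b) ≃ ρ a * ρ b
  ρ-* zero b = ≃-sym (UP.*-zeroˡ (ρ b))
  ρ-* (suc a) zero =
    subst (λ z → ρ z ≃ ρ (suc a) * ρ zero) (sym (ℕP.*-zeroʳ (suc a))) (≃-sym (UP.*-zeroʳ (ρ (suc a))))
  ρ-* (suc a) (suc b) = *≡* refl

  ιn-suc*ρ : ∀ d → ιn (suc d) * ρ (suc d) ≃ 1ℚᵘ
  ιn-suc*ρ d = UP.*-inverseʳ (ιn (suc d))

  mkℚᵘ≃ι*ρ : ∀ z d → mkℚᵘ z d ≃ ι z * ρ (suc d)
  mkℚᵘ≃ι*ρ z d =
    *≡* (trans (cong (λ k → z ℤ.* + suc k) (ℕP.+-identityʳ d)) (cong (ℤ._* + suc d) (sym (ℤP.*-identityʳ z))))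

  sumTo : (ℕ → ℚᵘ) → ℕ → ℚᵘ
  sumTo h zero = 0ℚᵘ
  sumTo h (suc N) = h 0 + sumTo (λ k → h (suc k)) N

  sumTo-cong : ∀ {h h'} N → (∀ k → h k ≃ h' k) → sumTo h N ≃ sumTo h' N
  sumTo-cong zero eq = ≃-refl
  sumTo-cong (suc N) eq = UP.+-cong (eq 0) (sumTo-cong N (λ k → eq (suc k)))

  sumTo-+ : ∀ h h' N → sumTo (λ k → h k + h' k) N ≃ sumTo h N + sumTo h' N
  sumTo-+ h h' zero = ≃-sym (UP.+-identityˡ 0ℚᵘ)
  sumTo-+ h h' (suc N) = ≃-trans (UP.+-congʳ (h 0 + h' 0) (sumTo-+ (h ∘ suc) (h' ∘ suc) N))
    (solve 4 (λ a b c d → (a :+ b) :+ (c :+ d) := (a :+ c) :+ (b :+ d)) ≃-refl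
             (h 0) (h' 0) (sumTo (h ∘ suc) N) (sumTo (h' ∘ suc) N))
    where open +-*-Solver

  sumTo-scale : ∀ q h N → sumTo (λ k → q * h k) N ≃ q * sumTo h N
  sumTo-scale q h zero = ≃-sym (UP.*-zeroʳ q)
  sumTo-scale q h (suc N) = ≃-trans (UP.+-congʳ (q * h 0) (sumTo-scale q (λ k → h (suc k)) N))
    (solve 3 (λ q a b → q :* a :+ q :* b := q :* (a :+ b)) ≃-refl q (h 0) (sumTo (λ k → h (suc k)) N))
    where open +-*-Solver

  sumTo-neg : ∀ h N → sumTo (λ k → - h k) N ≃ - sumTo h N
  sumTo-neg h zero = ≃-refl
  sumTo-neg h (suc N) = ≃-trans (UP.+-congʳ (- h 0) (sumTo-neg (λ k → h (suc k)) N))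
    (solve 2 (λ a b → (:- a) :+ (:- b) := :- (a :+ b)) ≃-refl (h 0) (sumTo (λ k → h (suc k)) N))
    where open +-*-Solver

  sumTo-zero : ∀ h N → (∀ k → h k ≃ 0ℚᵘ) → sumTo h N ≃ 0ℚᵘ
  sumTo-zero h zero eq = ≃-refl
  sumTo-zero h (suc N) eq =
    ≃-trans (UP.+-cong (eq 0) (sumTo-zero (h ∘ suc) N (eq ∘ suc))) (UP.+-identityˡ 0ℚᵘ)

  ι*0-term : ∀ x r → ι (x ℤ.* + 0) * r ≃ 0ℚᵘ
  ι*0-term x r = ≃-trans (UP.*-congʳ {r} (≃-reflexive (cong ι (ℤP.*-zeroʳ x)))) (UP.*-zeroˡ r)

  ιn*ρ≃1 : ∀ X → ℕ.NonZero X → ιn X * ρ X ≃ 1ℚᵘ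
  ιn*ρ≃1 (suc d) _ = ιn-suc*ρ d

  neg1^-+ : ∀ e k → neg1^ (e ℕ.+ k) ≡ neg1^ e ℤ.* neg1^ k
  neg1^-+ zero k = sym (ℤP.*-identityˡ (neg1^ k))
  neg1^-+ (suc e) k = trans (cong ℤ.-_ (neg1^-+ e k)) (ℤP.neg-distribˡ-* (neg1^ e) (neg1^ k))

  binomial*factorials : ∀ F G → ((F ℕ.+ G) C G) ℕ.* (G ! ℕ.* (F ℕ.+ G ℕ.∸ G) !) ≡ (F ℕ.+ G) !
  binomial*factorials F G = trans (cong (ℕ._* (G ! ℕ.* (F ℕ.+ G ℕ.∸ G) !)) (CSpec.nCk≡n!/k![n-k]! le))
    (m/n*n≡m {{ G ℕP.!* (F ℕ.+ G ℕ.∸ G) !≢0 }} (k![n∸k]!∣n! le))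
    where
    le : G ≤ F ℕ.+ G
    le = ℕP.m≤n+m G F

  factorial-split : ∀ F G → (suc (F ℕ.+ G)) ! ≡ (suc (F ℕ.+ G) ℕ.* ((F ℕ.+ G) C G)) ℕ.* (F ! ℕ.* G !)
  factorial-split F G = begin
      suc (F ℕ.+ G) ℕ.* (F ℕ.+ G) !
    ≡⟨ cong (suc (F ℕ.+ G) ℕ.*_) (sym (binomial*factorials F G)) ⟩
      suc (F ℕ.+ G) ℕ.* (((F ℕ.+ G) C G) ℕ.* (G ! ℕ.* (F ℕ.+ G ℕ.∸ G) !))
    ≡⟨ cong (λ z → suc (F ℕ.+ G) ℕ.* (((F ℕ.+ G) C G) ℕ.* (G ! ℕ.* z !))) (ℕP.m+n∸n≡m F G) ⟩
      suc (F ℕ.+ G) ℕ.* (((F ℕ.+ G) C G) ℕ.* (G ! ℕ.* F !))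
    ≡⟨ cong (λ z → suc (F ℕ.+ G) ℕ.* (((F ℕ.+ G) C G) ℕ.* z)) (ℕP.*-comm (G !) (F !)) ⟩
      suc (F ℕ.+ G) ℕ.* (((F ℕ.+ G) C G) ℕ.* (F ! ℕ.* G !))
    ≡⟨ sym (ℕP.*-assoc (suc (F ℕ.+ G)) ((F ℕ.+ G) C G) (F ! ℕ.* G !)) ⟩
      (suc (F ℕ.+ G) ℕ.* ((F ℕ.+ G) C G)) ℕ.* (F ! ℕ.* G !) ∎
    where open ≡-Reasoning

  open UP.≃-Reasoning

  -- betaSum F s N = Σ_{k<N} (-1)^k C(F,k)/(s+k+1); for N > F it is the Beta integral
  -- ∫₀¹ t^s (1-t)^F dt, with closed form betaValue F s = F! s!/(F+s+1)!.
  betaSum : ℕ → ℕ → ℕ → ℚᵘ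
  betaSum F s N = sumTo (λ k → ι (neg1^ k ℤ.* + (F C k)) * ρ (suc (s ℕ.+ k))) N

  -- Pascal's rule C(F+1,k+1) = C(F,k+1) + C(F,k) splits betaSum (F+1) s.
  betaSum-pascal : ∀ F s N → betaSum (suc F) s (suc N) ≃ betaSum F s (suc N) - betaSum F (suc s) N
  betaSum-pascal F s N = begin
      t0 + sumTo T1 N
    ≈⟨ UP.+-congʳ t0 (sumTo-cong N pt) ⟩
      t0 + sumTo (λ k → X k + - Y k) N
    ≈⟨ UP.+-congʳ t0 (≃-trans (sumTo-+ X (λ k → - Y k) N) (UP.+-congʳ (sumTo X N) (sumTo-neg Y N))) ⟩
      t0 + (sumTo X N + - sumTo Y N)
    ≈⟨ solve 3 (λ a b c → a :+ (b :+ :- c) := (a :+ b) :+ :- c) ≃-refl t0 (sumTo X N) (sumTo Y N) ⟩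
      (t0 + sumTo X N) - sumTo Y N ∎
    where
    open +-*-Solver
    t0 : ℚᵘ
    t0 = ι (neg1^ 0 ℤ.* + (F C 0)) * ρ (suc (s ℕ.+ 0))
    T1 X Y : ℕ → ℚᵘ
    T1 k = ι (neg1^ (suc k) ℤ.* + (suc F C suc k)) * ρ (suc (s ℕ.+ suc k))
    X k = ι (neg1^ (suc k) ℤ.* + (F C suc k)) * ρ (suc (s ℕ.+ suc k))
    Y k = ι (neg1^ k ℤ.* + (F C k)) * ρ (suc (suc s ℕ.+ k))
    pt : ∀ k → T1 k ≃ X k + - Y k
    pt k = begin
        T1 k
      ≈⟨ ≃-reflexive (cong (λ z → ι (neg1^ (suc k) ℤ.* z) * ρ (suc (s ℕ.+ suc k)))
           (trans (cong +_ (sym (nCk+nC[k+1]≡[n+1]C[k+1] F k))) (ℤP.pos-+ (F C k) (F C suc k)))) ⟩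
        ι (neg1^ (suc k) ℤ.* (+ (F C k) ℤ.+ + (F C suc k))) * r
      ≈⟨ UP.*-congʳ (UP.*-congˡ {ι (neg1^ (suc k))} (ι-+ (+ (F C k)) (+ (F C suc k)))) ⟩
        (- ι (neg1^ k)) * (ι (+ (F C k)) + ι (+ (F C suc k))) * r
      ≈⟨ solve 4 (λ x a b r → (:- x) :* (a :+ b) :* r := (:- x) :* b :* r :+ (:- (x :* a :* r))) ≃-refl
           (ι (neg1^ k)) (ι (+ (F C k))) (ι (+ (F C suc k))) r ⟩
        X k + - (ι (neg1^ k ℤ.* + (F C k)) * r)
      ≈⟨ ≃-reflexive (cong (λ z → X k + - (ι (neg1^ k ℤ.* + (F C k)) * ρ (suc z))) (ℕP.+-suc s k)) ⟩
        X k + - Y k ∎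
      where r = ρ (suc (s ℕ.+ suc k))

  betaSum-0 : ∀ s N → betaSum 0 s (suc N) ≃ ρ (suc s)
  betaSum-0 s N = begin
      ι (+ 1) * ρ (suc (s ℕ.+ 0)) + sumTo (λ k → ι (neg1^ (suc k) ℤ.* + 0) * ρ (suc (s ℕ.+ suc k))) N
    ≈⟨ UP.+-cong (≃-trans (UP.*-identityˡ _) (≃-reflexive (cong (λ z → ρ (suc z)) (ℕP.+-identityʳ s))))
                 (sumTo-zero _ N (λ k → ι*0-term (neg1^ (suc k)) _)) ⟩
      ρ (suc s) + 0ℚᵘ
    ≈⟨ UP.+-identityʳ _ ⟩
      ρ (suc s) ∎

  betaValue : ℕ → ℕ → ℚᵘ
  betaValue F s = ιn (F ! ℕ.* s !) * ρ ((suc (F ℕ.+ s)) !)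

  -- the closed form satisfies the same recursion: with X = F!, Y = s!,
  -- W = F+s+2 and R = 1/(F+s+2)!, it reads X Y W R - X (s+1) Y R = (F+1) X Y R.
  betaValue-pascal : ∀ F s → betaValue F s - betaValue F (suc s) ≃ betaValue (suc F) s
  betaValue-pascal F s = begin
      betaValue F s - betaValue F (suc s)
    ≈⟨ UP.+-cong value-s (UP.-‿cong value-s+1) ⟩
      ιn X * ιn Y * (ιn (suc F) + ιn (suc s)) * R - ιn X * (ιn (suc s) * ιn Y) * R
    ≈⟨ solve 5 (λ x y f t r → x :* y :* (f :+ t) :* r :- x :* (t :* y) :* r := f :* x :* y :* r) ≃-refl
               (ιn X) (ιn Y) (ιn (suc F)) (ιn (suc s)) R ⟩
      ιn (suc F) * ιn X * ιn Y * R
    ≈⟨ ≃-sym value-F+1 ⟩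
      betaValue (suc F) s ∎
    where
    open +-*-Solver
    X Y P W : ℕ
    X = F !
    Y = s !
    P = (suc (F ℕ.+ s)) !
    W = suc (suc (F ℕ.+ s))
    R : ℚᵘ
    R = ρ (W ℕ.* P)
    ρP : ρ P ≃ ιn W * R
    ρP = ≃-sym (begin
        ιn W * R                  ≈⟨ UP.*-congˡ {ιn W} (ρ-* W P) ⟩
        ιn W * (ρ W * ρ P)        ≈⟨ ≃-sym (UP.*-assoc (ιn W) (ρ W) (ρ P)) ⟩
        ιn W * ρ W * ρ P          ≈⟨ UP.*-congʳ {ρ P} (ιn-suc*ρ (suc (F ℕ.+ s))) ⟩
        1ℚᵘ * ρ P                 ≈⟨ UP.*-identityˡ (ρ P) ⟩
        ρ P ∎)
    W≃ : ιn W ≃ ιn (suc F) + ιn (suc s)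
    W≃ = ≃-trans (≃-reflexive (cong (λ z → ιn (suc z)) (sym (ℕP.+-suc F s)))) (ιn-+ (suc F) (suc s))
    value-s : betaValue F s ≃ ιn X * ιn Y * (ιn (suc F) + ιn (suc s)) * R
    value-s = begin
        ιn (X ℕ.* Y) * ρ P            ≈⟨ UP.*-cong (ιn-* X Y) ρP ⟩
        ιn X * ιn Y * (ιn W * R)      ≈⟨ ≃-sym (UP.*-assoc (ιn X * ιn Y) (ιn W) R) ⟩
        ιn X * ιn Y * ιn W * R        ≈⟨ UP.*-congʳ {R} (UP.*-congˡ {ιn X * ιn Y} W≃) ⟩
        ιn X * ιn Y * (ιn (suc F) + ιn (suc s)) * R ∎
    value-s+1 : betaValue F (suc s) ≃ ιn X * (ιn (suc s) * ιn Y) * R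
    value-s+1 = UP.*-cong (≃-trans (ιn-* X (suc s ℕ.* Y)) (UP.*-congˡ {ιn X} (ιn-* (suc s) Y)))
                          (≃-reflexive (cong (λ z → ρ ((suc z) !)) (ℕP.+-suc F s)))
    value-F+1 : betaValue (suc F) s ≃ ιn (suc F) * ιn X * ιn Y * R
    value-F+1 = UP.*-congʳ {R} (≃-trans (ιn-* (suc F ℕ.* X) Y) (UP.*-congʳ {ιn Y} (ιn-* (suc F) X)))

  -- the Beta integral: both sides satisfy the same recursion and initial values
  betaSum≃betaValue : ∀ F s N → F < N → betaSum F s N ≃ betaValue F s
  betaSum≃betaValue zero s (suc N) _ = begin
      betaSum 0 s (suc N)
    ≈⟨ betaSum-0 s N ⟩
      ρ (suc s)
    ≈⟨ ≃-sym (UP.*-identityʳ (ρ (suc s))) ⟩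
      ρ (suc s) * 1ℚᵘ
    ≈⟨ UP.*-congˡ {ρ (suc s)} (≃-sym (ιn*ρ≃1 (s !) (s ℕP.!≢0))) ⟩
      ρ (suc s) * (ιn (s !) * ρ (s !))
    ≈⟨ solve 3 (λ a b c → a :* (b :* c) := b :* (a :* c)) ≃-refl (ρ (suc s)) (ιn (s !)) (ρ (s !)) ⟩
      ιn (s !) * (ρ (suc s) * ρ (s !))
    ≈⟨ UP.*-cong (≃-reflexive (cong ιn (sym (ℕP.*-identityˡ (s !))))) (≃-sym (ρ-* (suc s) (s !))) ⟩
      betaValue 0 s ∎
    where open +-*-Solver
  betaSum≃betaValue (suc F) s (suc N) (s≤s F<N) = begin
      betaSum (suc F) s (suc N)
    ≈⟨ betaSum-pascal F s N ⟩
      betaSum F s (suc N) - betaSum F (suc s) N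
    ≈⟨ UP.+-cong (betaSum≃betaValue F s (suc N) (ℕP.m<n⇒m<1+n F<N))
                 (UP.-‿cong (betaSum≃betaValue F (suc s) N F<N)) ⟩
      betaValue F s - betaValue F (suc s)
    ≈⟨ betaValue-pascal F s ⟩
      betaValue (suc F) s ∎

  -- shiftedSum F G s e N = Σ_{k<N} (-1)^{e+k} binomShift F G k/(s+k+1); its first G
  -- terms vanish and dropping them shifts s and e by G.
  shiftedSum : ℕ → ℕ → ℕ → ℕ → ℕ → ℚᵘ
  shiftedSum F G s e N = sumTo (λ k → ι (neg1^ (e ℕ.+ k) ℤ.* + binomShift F G k) * ρ (suc (s ℕ.+ k))) N

  shiftedSum-skip : ∀ F G s e N → shiftedSum F (suc G) s e (suc N) ≃ shiftedSum F G (suc s) (suc e) N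
  shiftedSum-skip F G s e N =
    ≃-trans (UP.+-congˡ (sumTo _ N) (ι*0-term (neg1^ (e ℕ.+ 0)) (ρ (suc (s ℕ.+ 0)))))
      (≃-trans (UP.+-identityˡ _) (sumTo-cong N (λ k → ≃-reflexive
        (cong₂ (λ u v → ι (neg1^ u ℤ.* + binomShift F G k) * ρ (suc v)) (ℕP.+-suc e k) (ℕP.+-suc s k)))))

  shiftedSum-skipAll : ∀ F G s e N → shiftedSum F G s e (G ℕ.+ N) ≃ shiftedSum F 0 (G ℕ.+ s) (G ℕ.+ e) N
  shiftedSum-skipAll F zero s e N = ≃-refl
  shiftedSum-skipAll F (suc G) s e N = ≃-trans (shiftedSum-skip F G s e (G ℕ.+ N))
    (≃-trans (shiftedSum-skipAll F G (suc s) (suc e) N)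
      (≃-reflexive (cong₂ (λ u v → shiftedSum F 0 u v N) (ℕP.+-suc G s) (ℕP.+-suc G e))))

  shiftedSum-unshifted : ∀ F s e N → shiftedSum F 0 s e N ≃ ι (neg1^ e) * betaSum F s N
  shiftedSum-unshifted F s e N = ≃-trans (sumTo-cong N pt) (sumTo-scale (ι (neg1^ e)) _ N)
    where
    open +-*-Solver
    pt : ∀ k → ι (neg1^ (e ℕ.+ k) ℤ.* + (F C k)) * ρ (suc (s ℕ.+ k))
             ≃ ι (neg1^ e) * (ι (neg1^ k ℤ.* + (F C k)) * ρ (suc (s ℕ.+ k)))
    pt k = ≃-trans (≃-reflexive (cong (λ z → ι (z ℤ.* + (F C k)) * ρ (suc (s ℕ.+ k))) (neg1^-+ e k)))
      (solve 4 (λ a b c r → a :* b :* c :* r := a :* (b :* c :* r)) ≃-refl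
               (ι (neg1^ e)) (ι (neg1^ k)) (ι (+ (F C k))) (ρ (suc (s ℕ.+ k))))

  betaValue≃recip : ∀ F G → betaValue F G ≃ ρ (suc (F ℕ.+ G) ℕ.* ((F ℕ.+ G) C G))
  betaValue≃recip F G = begin
      ιn X * ρ ((suc (F ℕ.+ G)) !)
    ≈⟨ UP.*-congˡ {ιn X} (≃-reflexive (cong ρ fact)) ⟩
      ιn X * ρ (D ℕ.* X)
    ≈⟨ UP.*-congˡ {ιn X} (ρ-* D X) ⟩
      ιn X * (ρ D * ρ X)
    ≈⟨ solve 3 (λ a b c → a :* (b :* c) := b :* (a :* c)) ≃-refl (ιn X) (ρ D) (ρ X) ⟩
      ρ D * (ιn X * ρ X)
    ≈⟨ UP.*-congˡ {ρ D} (ιn*ρ≃1 X (F ℕP.!* G !≢0)) ⟩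
      ρ D * 1ℚᵘ
    ≈⟨ UP.*-identityʳ (ρ D) ⟩
      ρ D ∎
    where
    open +-*-Solver
    X D : ℕ
    X = F ! ℕ.* G !
    D = suc (F ℕ.+ G) ℕ.* ((F ℕ.+ G) C G)
    fact : (suc (F ℕ.+ G)) ! ≡ D ℕ.* X
    fact = factorial-split F G

  alternating-sumᵘ : ∀ F G → sumTo (λ k → ι (neg1^ k ℤ.* + binomShift F G k) * ρ (suc k)) (suc (F ℕ.+ G))
                              ≃ ι (neg1^ G) * ρ (suc (F ℕ.+ G) ℕ.* ((F ℕ.+ G) C G))
  alternating-sumᵘ F G = begin
      shiftedSum F G 0 0 (suc (F ℕ.+ G))
    ≈⟨ ≃-reflexive (cong (shiftedSum F G 0 0) (trans (cong suc (ℕP.+-comm F G)) (sym (ℕP.+-suc G F)))) ⟩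
      shiftedSum F G 0 0 (G ℕ.+ suc F)
    ≈⟨ shiftedSum-skipAll F G 0 0 (suc F) ⟩
      shiftedSum F 0 (G ℕ.+ 0) (G ℕ.+ 0) (suc F)
    ≈⟨ ≃-reflexive (cong (λ z → shiftedSum F 0 z z (suc F)) (ℕP.+-identityʳ G)) ⟩
      shiftedSum F 0 G G (suc F)
    ≈⟨ shiftedSum-unshifted F G G (suc F) ⟩
      ι (neg1^ G) * betaSum F G (suc F)
    ≈⟨ UP.*-congˡ {ι (neg1^ G)} (betaSum≃betaValue F G (suc F) (ℕP.n<1+n F)) ⟩
      ι (neg1^ G) * betaValue F G
    ≈⟨ UP.*-congˡ {ι (neg1^ G)} (betaValue≃recip F G) ⟩
      ι (neg1^ G) * ρ (suc (F ℕ.+ G) ℕ.* ((F ℕ.+ G) C G)) ∎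

  toℚᵘ-sumℚ : ∀ (g : ℕ → ℚ) N → toℚᵘ (sumℚ (applyUpTo g N)) ≃ sumTo (λ k → toℚᵘ (g k)) N
  toℚᵘ-sumℚ g zero = *≡* refl
  toℚᵘ-sumℚ g (suc N) = ≃-trans (QP.toℚᵘ-homo-+ (g 0) (sumℚ (applyUpTo (g ∘ suc) N)))
    (UP.+-congʳ (toℚᵘ (g 0)) (toℚᵘ-sumℚ (g ∘ suc) N))

  toℚᵘ-/ : ∀ z d → toℚᵘ (z Q./ suc d) ≃ ι z * ρ (suc d)
  toℚᵘ-/ z d = ≃-trans (QP.toℚᵘ-fromℚᵘ (mkℚᵘ z d)) (mkℚᵘ≃ι*ρ z d)

  toℚᵘ-recipℕ : ∀ D → toℚᵘ (recipℕ D) ≃ ρ D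
  toℚᵘ-recipℕ zero = *≡* refl
  toℚᵘ-recipℕ (suc d) = QP.toℚᵘ-fromℚᵘ (mkℚᵘ (+ 1) d)

  alternating-sum : ∀ F G →
    sumℚ (map (λ k → (neg1^ k ℤ.* + binomShift F G k) Q./ suc k) (upTo (suc (F ℕ.+ G))))
      ≡ (neg1^ G Q./ 1) Q.* recipℕ (suc (F ℕ.+ G) ℕ.* ((F ℕ.+ G) C G))
  alternating-sum F G = QP.toℚᵘ-injective (begin
      toℚᵘ (sumℚ (map g (upTo (suc (F ℕ.+ G)))))
    ≈⟨ ≃-reflexive (cong (λ l → toℚᵘ (sumℚ l)) (LP.map-upTo g (suc (F ℕ.+ G)))) ⟩
      toℚᵘ (sumℚ (applyUpTo g (suc (F ℕ.+ G))))
    ≈⟨ toℚᵘ-sumℚ g (suc (F ℕ.+ G)) ⟩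
      sumTo (λ k → toℚᵘ (g k)) (suc (F ℕ.+ G))
    ≈⟨ sumTo-cong (suc (F ℕ.+ G)) (λ k → toℚᵘ-/ (neg1^ k ℤ.* + binomShift F G k) k) ⟩
      sumTo (λ k → ι (neg1^ k ℤ.* + binomShift F G k) * ρ (suc k)) (suc (F ℕ.+ G))
    ≈⟨ alternating-sumᵘ F G ⟩
      ι (neg1^ G) * ρ D
    ≈⟨ ≃-sym (≃-trans (QP.toℚᵘ-homo-* (neg1^ G Q./ 1) (recipℕ D))
                      (UP.*-cong (QP.toℚᵘ-fromℚᵘ (mkℚᵘ (neg1^ G) 0)) (toℚᵘ-recipℕ D))) ⟩
      toℚᵘ ((neg1^ G Q./ 1) Q.* recipℕ D) ∎)
    where
    g : ℕ → ℚ
    g k = (neg1^ k ℤ.* + binomShift F G k) Q./ suc k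
    D : ℕ
    D = suc (F ℕ.+ G) ℕ.* ((F ℕ.+ G) C G)


module PermutationCount where

  -- |S_n| = n!: the words of length k over an N-letter alphabet with distinct
  -- letters number N (N-1) ⋯ (N-k+1) = N P′ k, since a word i ∷ v is injective
  -- iff v is and i avoids the k letters of v.

  open import Defs using (allVecs; permsVec)
  open Counting
  open Enumeration
  open import Data.Nat using (ℕ; zero; suc; _+_; _*_; _∸_; _/_; _!)
  import Data.Nat.Properties as ℕP
  open import Data.Nat.DivMod using (/-congʳ; n/1≡n)
  open import Data.Nat.Combinatorics.Base using (_P′_)
  open import Data.Nat.Combinatorics.Specification using (nP′k≡n!/[n∸k]!)
  open import Data.Fin as Fin using (Fin)
  import Data.Fin.Properties as FinP
  open import Data.Vec as Vec using (Vec; []; _∷_; toList)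
  open import Data.List using (List; []; _∷_; map; length; filter; allFin)
  open import Data.Nat.ListAction renaming (sum to sumℕ)
  import Data.List.Properties as LP
  open import Data.List.Membership.Propositional using (_∈_; _∉_)
  import Data.List.Membership.Propositional.Properties as MemP
  import Data.List.Membership.DecPropositional as DecMem
  import Data.List.Relation.Unary.All as All
  import Data.List.Relation.Unary.All.Properties as AllP
  open import Data.List.Relation.Unary.Unique.Propositional using (Unique)
  import Data.List.Relation.Unary.Unique.Propositional.Properties as UniqP
  import Data.List.Relation.Unary.Unique.DecPropositional as UniqDec
  import Data.List.Relation.Unary.AllPairs as AllPairs
  open import Data.Product using (_×_; _,_; proj₂)
  open import Data.Empty using (⊥-elim)
  open import Data.Unit using (tt)
  open import Relation.Nullary using (Dec; yes; no)
  open import Relation.Nullary.Decidable using (_×-dec_; ¬?)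
  open import Relation.Binary.PropositionalEquality using (_≡_; refl; sym; trans; cong; cong₂; subst; module ≡-Reasoning)

  lookup-injective : ∀ {N k} (v : Vec (Fin N) k) → Unique (toList v) →
    ∀ {i j} → Vec.lookup v i ≡ Vec.lookup v j → i ≡ j
  lookup-injective (x ∷ v) (x∉v AllPairs.∷ u) {Fin.zero} {Fin.zero} eq = refl
  lookup-injective (x ∷ v) (x∉v AllPairs.∷ u) {Fin.zero} {Fin.suc j} eq = ⊥-elim (All.lookup x∉v (∈entries v j) eq)
    where
    ∈entries : ∀ {k} (w : Vec _ k) j → Vec.lookup w j ∈ toList w
    ∈entries w j = subst (Vec.lookup w j ∈_) (sym (toList-lookup w)) (MemP.∈-map⁺ (Vec.lookup w) (MemP.∈-allFin j))
  lookup-injective (x ∷ v) (x∉v AllPairs.∷ u) {Fin.suc i} {Fin.zero} eq =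
    sym (lookup-injective (x ∷ v) (x∉v AllPairs.∷ u) (sym eq))
  lookup-injective (x ∷ v) (x∉v AllPairs.∷ u) {Fin.suc i} {Fin.suc j} eq = cong Fin.suc (lookup-injective v u eq)

  unique? : ∀ {N k} (v : Vec (Fin N) k) → Dec (Unique (toList v))
  unique? v = UniqDec.unique? FinP._≟_ (toList v)

  module _ (N : ℕ) where

    _∈?_ : (i : Fin N) (xs : List (Fin N)) → Dec (i ∈ xs)
    i ∈? xs = DecMem._∈?_ FinP._≟_ i xs

    #∈ : (xs : List (Fin N)) → Unique xs → count (_∈? xs) (allFin N) ≡ length xs
    #∈ xs u = trans (sym (count-all (λ _ → yes tt) (filter (_∈? xs) (allFin N)) (λ _ _ → tt)))
      (trans (count-set (λ _ → yes tt) (UniqP.filter⁺ (_∈? xs) (UniqP.allFin⁺ N)) u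
          (λ x x∈ → proj₂ (MemP.∈-filter⁻ (_∈? xs) {xs = allFin N} x∈))
          (λ x x∈ → MemP.∈-filter⁺ (_∈? xs) (MemP.∈-allFin x) x∈))
        (count-all (λ _ → yes tt) xs (λ _ _ → tt)))

    #∉ : (xs : List (Fin N)) → Unique xs → count (λ i → ¬? (i ∈? xs)) (allFin N) ≡ N ∸ length xs
    #∉ xs u = trans (sym (ℕP.m+n∸m≡n #in #out)) (cong₂ _∸_ (sym split) (#∈ xs u))
      where
      #in #out : ℕ
      #in = count (_∈? xs) (allFin N)
      #out = count (λ i → ¬? (i ∈? xs)) (allFin N)
      everything : ∀ {P : Fin N → Set} (P? : ∀ i → Dec (P i)) →
        count (λ i → yes tt ×-dec P? i) (allFin N) ≡ count P? (allFin N)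
      everything P? = count-cong _ P? (allFin N) (λ _ _ p → proj₂ p) (λ _ _ q → tt , q)
      split : N ≡ #in + #out
      split = begin
          N
        ≡⟨ sym (trans (count-all (λ _ → yes tt) (allFin N) (λ _ _ → tt)) (LP.length-tabulate (λ x → x))) ⟩
          count (λ _ → yes tt) (allFin N)
        ≡⟨ count-split (λ _ → yes tt) (_∈? xs) (allFin N) ⟩
          count (λ i → yes tt ×-dec i ∈? xs) (allFin N) + count (λ i → yes tt ×-dec ¬? (i ∈? xs)) (allFin N)
        ≡⟨ cong₂ _+_ (everything (_∈? xs)) (everything (λ i → ¬? (i ∈? xs))) ⟩
          #in + #out ∎
        where open ≡-Reasoning

    length-toList : ∀ {k} (v : Vec (Fin N) k) → length (toList v) ≡ k
    length-toList [] = refl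
    length-toList (x ∷ v) = cong suc (length-toList v)

    #injective-words : ∀ k → count (unique? {N} {k}) (allVecs N k) ≡ N P′ k
    #injective-words zero = refl
    #injective-words (suc k) = begin
        count unique? (allVecs N (suc k))
      ≡⟨ count-allVecs-suc N k unique? ⟩
        sumℕ (map (λ i → count (λ v → unique? (i ∷ v)) (allVecs N k)) (allFin N))
      ≡⟨ sum-cong-∈ (allFin N) (λ i _ → count-cong _ (fresh? i) (allVecs N k)
                                        (λ v _ → fresh-of-unique i v) (λ v _ → unique-of-fresh i v)) ⟩
        sumℕ (map (λ i → count (fresh? i) (allVecs N k)) (allFin N))
      ≡⟨ sum-swap (allFin N) (allVecs N k) fresh? ⟩
        sumℕ (map (λ v → count (λ i → fresh? i v) (allFin N)) (allVecs N k))
      ≡⟨ sum-cong-∈ (allVecs N k) (λ v _ → #fresh v) ⟩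
        sumℕ (map (λ v → ind (unique? v) (N ∸ k)) (allVecs N k))
      ≡⟨ sum-ind unique? (N ∸ k) (allVecs N k) ⟩
        (N ∸ k) * count unique? (allVecs N k)
      ≡⟨ cong ((N ∸ k) *_) (#injective-words k) ⟩
        (N ∸ k) * (N P′ k) ∎
      where
      open ≡-Reasoning
      fresh? : ∀ i (v : Vec (Fin N) k) → Dec ((i ∉ toList v) × Unique (toList v))
      fresh? i v = ¬? (i ∈? toList v) ×-dec unique? v
      fresh-of-unique : ∀ i (v : Vec (Fin N) k) → Unique (toList (i ∷ v)) → (i ∉ toList v) × Unique (toList v)
      fresh-of-unique i v (i∉v AllPairs.∷ u) = AllP.All¬⇒¬Any i∉v , u
      unique-of-fresh : ∀ i (v : Vec (Fin N) k) → (i ∉ toList v) × Unique (toList v) → Unique (toList (i ∷ v))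
      unique-of-fresh i v (i∉v , u) = AllP.¬Any⇒All¬ (toList v) i∉v AllPairs.∷ u
      #fresh : ∀ v → count (λ i → fresh? i v) (allFin N) ≡ ind (unique? v) (N ∸ k)
      #fresh v = trans (count-cong _ (λ i → unique? v ×-dec ¬? (i ∈? toList v)) (allFin N)
                                   (λ _ _ (p , q) → q , p) (λ _ _ (p , q) → q , p))
        (trans (count-and-const (unique? v) (λ i → ¬? (i ∈? toList v)) (allFin N)) (letters (unique? v)))
        where
        letters : (d : Dec (Unique (toList v))) →
          ind d (count (λ i → ¬? (i ∈? toList v)) (allFin N)) ≡ ind d (N ∸ k)
        letters (yes u) = trans (#∉ (toList v) u) (cong (N ∸_) (length-toList v))
        letters (no _) = refl

  nP′n≡n! : ∀ n → n P′ n ≡ n !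
  nP′n≡n! n = begin
      n P′ n
    ≡⟨ nP′k≡n!/[n∸k]! (ℕP.≤-refl {n}) ⟩
      n ! / (n ∸ n) !
    ≡⟨ /-congʳ (cong _! (ℕP.n∸n≡0 n)) ⟩
      n ! / 1
    ≡⟨ n/1≡n (n !) ⟩
      n ! ∎
    where
    open ≡-Reasoning
    instance _ = (n ∸ n) ℕP.!≢0

  length-permsVec : ∀ n → length (permsVec n) ≡ n !
  length-permsVec n = trans (#injective-words n n) (nP′n≡n! n)

  permsVec-unique : ∀ n v → v ∈ permsVec n → Unique (toList v)
  permsVec-unique n v v∈ = proj₂ (MemP.∈-filter⁻ unique? {xs = allVecs n n} v∈)


module WebWorld where

  open import Defs
  open Counting using (map-cong-∈; sum-const)
  open Enumeration using (map-allFin-suc; tabulate-toℕ)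
  open Polynomials
  open RankCriterion using (Factorisation)
  open Staircase using (ascentsFrom; ascents+descents; increasing-run)
  open ColouringCount using (module Count; length-Dπ)
  open AlternatingSum using (alternating-sum; ιn; ρ; ιn-*; ιn-+; ιn-suc*ρ; toℚᵘ-recipℕ)
  open PermutationCount using (lookup-injective; length-permsVec; permsVec-unique)
  open import Data.Nat using (ℕ; zero; suc; _+_; _*_; _∸_; _≤_; z≤n; s≤s; _!)
  import Data.Nat.Properties as ℕP
  open import Data.Nat.ListAction renaming (sum to sumℕ)
  open import Data.Nat.Combinatorics using (_C_)
  open import Data.Integer as ℤ using (+_)
  open import Data.Rational as ℚ using (ℚ; _/_; toℚᵘ; 1ℚ)
  import Data.Rational.Properties as ℚP
  open import Data.Rational.Unnormalised as U using (mkℚᵘ; _≃_; 1ℚᵘ)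
  import Data.Rational.Unnormalised.Properties as UP
  open import Data.Rational.Unnormalised.Solver using (module +-*-Solver)
  open import Data.Fin as Fin using (Fin; toℕ)
  open import Data.Fin.Permutation using (Permutation′; _⟨$⟩ʳ_; _⟨$⟩ˡ_; inverseˡ; inverseʳ)
  open import Data.Vec as Vec using (Vec)
  open import Data.List as List using (List; []; _∷_; map; length; allFin; upTo; applyUpTo)
  import Data.List.Properties as LP
  open import Data.List.Membership.Propositional using (_∈_)
  open import Data.Product using (proj₁; proj₂)
  open import Function using (_∘_)
  open import Relation.Binary.PropositionalEquality using (_≡_; refl; sym; trans; cong; cong₂; module ≡-Reasoning)

  M-coefficients : ∀ D₁ D₂ F G → (∀ ℓ → f D₁ D₂ (suc ℓ) ≡ binomShift F G ℓ) →
    ∀ k → Mcoeff D₁ D₂ k ≡ coeff (X^ (suc G) *P (1+X ^P F)) k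
  M-coefficients D₁ D₂ F G f≡ zero = sym (coeff-binomShift F (suc G) 0)
  M-coefficients D₁ D₂ F G f≡ (suc k) = trans (f≡ k) (sym (coeff-binomShift F (suc G) (suc k)))

  R-value : ∀ D₁ D₂ F G → length D₁ ≡ suc (F + G) → (∀ ℓ → f D₁ D₂ (suc ℓ) ≡ binomShift F G ℓ) →
    Rval D₁ D₂ ≡ (neg1^ G / 1) ℚ.* recipℕ (suc (F + G) * ((F + G) C G))
  R-value D₁ D₂ F G |D₁| f≡ = begin
      sumℚ (map (λ k → (neg1^ k ℤ.* + f D₁ D₂ (suc k)) / suc k) (upTo (length D₁)))
    ≡⟨ cong (λ L → sumℚ (map (λ k → (neg1^ k ℤ.* + f D₁ D₂ (suc k)) / suc k) (upTo L))) |D₁| ⟩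
      sumℚ (map (λ k → (neg1^ k ℤ.* + f D₁ D₂ (suc k)) / suc k) (upTo (suc (F + G))))
    ≡⟨ cong sumℚ (LP.map-cong (λ k → cong (λ z → (neg1^ k ℤ.* + z) / suc k) (f≡ k)) (upTo (suc (F + G)))) ⟩
      sumℚ (map (λ k → (neg1^ k ℤ.* + binomShift F G k) / suc k) (upTo (suc (F + G))))
    ≡⟨ alternating-sum F G ⟩
      (neg1^ G / 1) ℚ.* recipℕ (suc (F + G) * ((F + G) C G)) ∎
    where open ≡-Reasoning

  permutationFactorisation : ∀ {n} (π σ : Permutation′ n) → Factorisation n
  permutationFactorisation π σ = record
    { π = π ⟨$⟩ʳ_
    ; σ = σ ⟨$⟩ʳ_
    ; τ = λ i → σ ⟨$⟩ˡ (π ⟨$⟩ʳ i)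
    ; a = λ j → π ⟨$⟩ˡ (σ ⟨$⟩ʳ j)
    ; σ-inj = λ eq → trans (sym (inverseˡ σ)) (trans (cong (σ ⟨$⟩ˡ_) eq) (inverseˡ σ))
    ; τ∘a = λ j → trans (cong (σ ⟨$⟩ˡ_) (inverseʳ π)) (inverseˡ σ)
    ; a∘τ = λ i → trans (cong (π ⟨$⟩ˡ_) (inverseʳ σ)) (inverseˡ π)
    ; σ∘τ = λ i → inverseʳ σ
    }

  diagonalFactorisation : ∀ {n} (ψ : Fin n → Fin n) → (∀ {i j} → ψ i ≡ ψ j → i ≡ j) → Factorisation n
  diagonalFactorisation ψ ψ-inj = record
    { π = ψ ; σ = ψ ; τ = λ i → i ; a = λ i → i ; σ-inj = ψ-inj
    ; τ∘a = λ _ → refl ; a∘τ = λ _ → refl ; σ∘τ = λ _ → refl }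

  module Coefficients (m : ℕ) (φ : Factorisation (suc m)) where
    open Factorisation φ
    open Count m φ public using (a₀; as)
    open Count m φ using (module WithColours)

    F G : ℕ
    F = ascentsFrom a₀ as
    G = descentsFrom a₀ as

    F+G≡m : F + G ≡ m
    F+G≡m = trans (ascents+descents a₀ as) (trans (LP.length-map _ (allFin m)) (LP.length-tabulate (λ x → x)))

    f≡binomShift : ∀ ℓ → f (Dπ π) (Dπ σ) (suc ℓ) ≡ binomShift F G ℓ
    f≡binomShift ℓ = WithColours.f-formula (suc ℓ) (s≤s z≤n)

    M-formula : ∀ k → Mcoeff (Dπ π) (Dπ σ) k ≡ coeff (X^ (suc G) *P (1+X ^P F)) k
    M-formula = M-coefficients (Dπ π) (Dπ σ) F G f≡binomShift

    R-formula : Rval (Dπ π) (Dπ σ) ≡ (neg1^ G / 1) ℚ.* recipℕ (suc m * (m C G))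
    R-formula = trans (R-value (Dπ π) (Dπ σ) F G (trans (length-Dπ π) (cong suc (sym F+G≡m))) f≡binomShift)
      (cong (λ w → (neg1^ G / 1) ℚ.* recipℕ (suc w * (w C G))) F+G≡m)

    -- the descents of a are those of the word read off by minimal
    descents-along-a : descents (map (toℕ ∘ a) (allFin (suc m))) ≡ G
    descents-along-a = cong descents (map-allFin-suc (toℕ ∘ a))

  module Diagonal (m : ℕ) (ψ : Fin (suc m) → Fin (suc m)) (ψ-inj : ∀ {i j} → ψ i ≡ ψ j → i ≡ j) where
    open Coefficients m (diagonalFactorisation ψ ψ-inj)

    as≡1-to-m : as ≡ applyUpTo suc m
    as≡1-to-m = trans (LP.map-tabulate (λ x → x) (toℕ ∘ Fin.suc)) (tabulate-toℕ m suc)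

    G≡0 : G ≡ 0
    G≡0 = trans (cong (descentsFrom 0) as≡1-to-m) (proj₁ (increasing-run m 0 suc z≤n (λ k → ℕP.n≤1+n (suc k))))

    F≡m : F ≡ m
    F≡m = trans (cong (ascentsFrom 0) as≡1-to-m) (proj₂ (increasing-run m 0 suc z≤n (λ k → ℕP.n≤1+n (suc k))))

    M-diagonal : ∀ k → Mcoeff (Dπ ψ) (Dπ ψ) k ≡ coeff (X^ 1 *P (1+X ^P m)) k
    M-diagonal k = trans (M-formula k) (cong₂ (λ g h → coeff (X^ (suc g) *P (1+X ^P h)) k) G≡0 F≡m)

    R-diagonal : Rval (Dπ ψ) (Dπ ψ) ≡ recipℕ (suc m)
    R-diagonal = begin
        Rval (Dπ ψ) (Dπ ψ)
      ≡⟨ R-formula ⟩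
        (neg1^ G / 1) ℚ.* recipℕ (suc m * (m C G))
      ≡⟨ cong (λ g → (neg1^ g / 1) ℚ.* recipℕ (suc m * (m C g))) G≡0 ⟩
        1ℚ ℚ.* recipℕ (suc m * 1)
      ≡⟨ ℚP.*-identityˡ _ ⟩
        recipℕ (suc m * 1)
      ≡⟨ cong recipℕ (ℕP.*-identityʳ (suc m)) ⟩
        recipℕ (suc m) ∎
      where open ≡-Reasoning

  sumℚ-const : {A : Set} (q : ℚ) (xs : List A) → sumℚ (map (λ _ → q) xs) ≡ (+ length xs / 1) ℚ.* q
  sumℚ-const q xs = ℚP.toℚᵘ-injective (UP.≃-trans (sumᵘ xs)
    (UP.≃-sym (UP.≃-trans (ℚP.toℚᵘ-homo-* (+ length xs / 1) q)
                          (UP.*-congʳ {toℚᵘ q} (ℚP.toℚᵘ-fromℚᵘ (mkℚᵘ (+ length xs) 0))))))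
    where
    open +-*-Solver
    sumᵘ : (xs : List _) → toℚᵘ (sumℚ (map (λ _ → q) xs)) ≃ ιn (length xs) U.* toℚᵘ q
    sumᵘ [] = UP.≃-sym (UP.*-zeroˡ (toℚᵘ q))
    sumᵘ (x ∷ xs) = UP.≃-trans (ℚP.toℚᵘ-homo-+ q (sumℚ (map (λ _ → q) xs)))
      (UP.≃-trans (UP.+-congʳ (toℚᵘ q) (sumᵘ xs))
        (UP.≃-trans (solve 2 (λ t l → t :+ l :* t := (con 1ℚᵘ :+ l) :* t) UP.≃-refl (toℚᵘ q) (ιn (length xs)))
          (UP.*-congʳ {toℚᵘ q} (UP.≃-sym (ιn-+ 1 (length xs))))))

  factorial/suc : ∀ m → (+ (suc m !) / 1) ℚ.* recipℕ (suc m) ≡ + (m !) / 1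
  factorial/suc m = ℚP.toℚᵘ-injective (begin
      toℚᵘ ((+ (suc m !) / 1) ℚ.* recipℕ (suc m))
    ≈⟨ UP.≃-trans (ℚP.toℚᵘ-homo-* (+ (suc m !) / 1) (recipℕ (suc m)))
         (UP.*-cong (ℚP.toℚᵘ-fromℚᵘ (mkℚᵘ (+ (suc m !)) 0)) (toℚᵘ-recipℕ (suc m))) ⟩
      ιn (suc m * m !) U.* ρ (suc m)
    ≈⟨ UP.*-congʳ {ρ (suc m)} (ιn-* (suc m) (m !)) ⟩
      ιn (suc m) U.* ιn (m !) U.* ρ (suc m)
    ≈⟨ solve 3 (λ a b r → a :* b :* r := b :* (a :* r)) UP.≃-refl (ιn (suc m)) (ιn (m !)) (ρ (suc m)) ⟩
      ιn (m !) U.* (ιn (suc m) U.* ρ (suc m))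
    ≈⟨ UP.*-congˡ {ιn (m !)} (ιn-suc*ρ m) ⟩
      ιn (m !) U.* 1ℚᵘ
    ≈⟨ UP.*-identityʳ (ιn (m !)) ⟩
      ιn (m !)
    ≈⟨ UP.≃-sym (ℚP.toℚᵘ-fromℚᵘ (mkℚᵘ (+ (m !)) 0)) ⟩
      toℚᵘ (+ (m !) / 1) ∎)
    where
    open +-*-Solver
    open UP.≃-Reasoning

  module Traces (m : ℕ) where
    n : ℕ
    n = suc m

    module D (v : Vec (Fin n) n) (v∈ : v ∈ permsVec n) =
      Diagonal m (Vec.lookup v) (lookup-injective v (permsVec-unique n v v∈))

    trace-R : trR n ≡ + (m !) / 1
    trace-R = begin
        sumℚ (map (λ v → Rval (Dπ (Vec.lookup v)) (Dπ (Vec.lookup v))) (permsVec n))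
      ≡⟨ cong sumℚ (map-cong-∈ (permsVec n) D.R-diagonal) ⟩
        sumℚ (map (λ _ → recipℕ n) (permsVec n))
      ≡⟨ sumℚ-const (recipℕ n) (permsVec n) ⟩
        (+ length (permsVec n) / 1) ℚ.* recipℕ n
      ≡⟨ cong (λ l → (+ l / 1) ℚ.* recipℕ n) (length-permsVec n) ⟩
        (+ (n !) / 1) ℚ.* recipℕ n
      ≡⟨ factorial/suc m ⟩
        + (m !) / 1 ∎
      where open ≡-Reasoning

    trace-M : ∀ k → trMcoeff n k ≡ coeff (scaleP (n !) (X^ 1 *P (1+X ^P m))) k
    trace-M k = begin
        sumℕ (map (λ v → Mcoeff (Dπ (Vec.lookup v)) (Dπ (Vec.lookup v)) k) (permsVec n))
      ≡⟨ cong sumℕ (map-cong-∈ (permsVec n) (λ v v∈ → D.M-diagonal v v∈ k)) ⟩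
        sumℕ (map (λ _ → coeff (X^ 1 *P (1+X ^P m)) k) (permsVec n))
      ≡⟨ sum-const _ (permsVec n) ⟩
        length (permsVec n) * coeff (X^ 1 *P (1+X ^P m)) k
      ≡⟨ cong (_* coeff (X^ 1 *P (1+X ^P m)) k) (length-permsVec n) ⟩
        n ! * coeff (X^ 1 *P (1+X ^P m)) k
      ≡⟨ sym (coeff-scaleP (n !) (X^ 1 *P (1+X ^P m)) k) ⟩
        coeff (scaleP (n !) (X^ 1 *P (1+X ^P m))) k ∎
      where open ≡-Reasoning

  permutation-injective : ∀ {n} (π : Permutation′ n) {i j} → π ⟨$⟩ʳ i ≡ π ⟨$⟩ʳ j → i ≡ j
  permutation-injective π eq = trans (sym (inverseˡ π)) (trans (cong (π ⟨$⟩ˡ_) eq) (inverseˡ π))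

  module PermutationPair (m : ℕ) (π σ : Permutation′ (suc m)) where
    open Coefficients m (permutationFactorisation π σ)

    minimal≡1+G : minimal π σ ≡ suc G
    minimal≡1+G = cong suc descents-along-a

    n∸minimal≡F : suc m ∸ minimal π σ ≡ F
    n∸minimal≡F = trans (cong (suc m ∸_) minimal≡1+G) (trans (cong (_∸ G) (sym F+G≡m)) (ℕP.m+n∸n≡m F G))

    M-minimal : ∀ k → Mcoeff (Dπ (π ⟨$⟩ʳ_)) (Dπ (σ ⟨$⟩ʳ_)) k
                      ≡ coeff (X^ (minimal π σ) *P (1+X ^P (suc m ∸ minimal π σ))) k
    M-minimal k =
      trans (M-formula k) (cong₂ (λ u w → coeff (X^ u *P (1+X ^P w)) k) (sym minimal≡1+G) (sym n∸minimal≡F))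

    R-minimal : Rval (Dπ (π ⟨$⟩ʳ_)) (Dπ (σ ⟨$⟩ʳ_))
                ≡ (neg1^ (minimal π σ ∸ 1) / 1) ℚ.* recipℕ (suc m * (m C (minimal π σ ∸ 1)))
    R-minimal =
      trans R-formula (cong (λ g → (neg1^ g / 1) ℚ.* recipℕ (suc m * (m C g))) (sym (cong (_∸ 1) minimal≡1+G)))


open import Defs
open WebWorld
open import Data.Nat using (ℕ; suc; _≤_; _∸_; _*_; _!; z≤n; s≤s)
open import Data.Nat.Combinatorics using (_C_)
open import Data.Integer using (+_)
open import Data.Rational as ℚ using (ℚ; _/_)
open import Data.Fin.Permutation using (Permutation′; _⟨$⟩ʳ_)
open import Data.Product using (_×_; _,_)
open import Relation.Binary.PropositionalEquality using (_≡_)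

theorem6p8 : (n : ℕ) → 1 ≤ n →
  ((π σ : Permutation′ n) →
    ((k : ℕ) → Mcoeff (Dπ (π ⟨$⟩ʳ_)) (Dπ (σ ⟨$⟩ʳ_)) k
                 ≡ coeff (X^ (minimal π σ) *P (1+X ^P (n ∸ minimal π σ))) k)
    × (Rval (Dπ (π ⟨$⟩ʳ_)) (Dπ (σ ⟨$⟩ʳ_))
         ≡ (neg1^ (minimal π σ ∸ 1) / 1) ℚ.* recipℕ (n * ((n ∸ 1) C (minimal π σ ∸ 1)))))
  × ((π : Permutation′ n) → Rval (Dπ (π ⟨$⟩ʳ_)) (Dπ (π ⟨$⟩ʳ_)) ≡ recipℕ n)
  × (trR n ≡ + ((n ∸ 1) !) / 1)
  × ((π : Permutation′ n) → (k : ℕ) →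
       Mcoeff (Dπ (π ⟨$⟩ʳ_)) (Dπ (π ⟨$⟩ʳ_)) k ≡ coeff (X^ 1 *P (1+X ^P (n ∸ 1))) k)
  × ((k : ℕ) → trMcoeff n k ≡ coeff (scaleP (n !) (X^ 1 *P (1+X ^P (n ∸ 1)))) k)
theorem6p8 (suc m) (s≤s z≤n) =
  (λ π σ → PermutationPair.M-minimal m π σ , PermutationPair.R-minimal m π σ) ,
  (λ π → Diagonal.R-diagonal m (π ⟨$⟩ʳ_) (permutation-injective π)) ,
  Traces.trace-R m ,
  (λ π → Diagonal.M-diagonal m (π ⟨$⟩ʳ_) (permutation-injective π)) ,
  Traces.trace-M m
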